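{- Let $k \geq 3$ be an integer, let $x_1,\dots,x_k$ be $k$ Boolean variables, let $C = \ell_1 \vee \cdots \vee \ell_k$ be a clause of width $k$ over $x_1,\dots,x_k$, and let $\alpha_{\mathsf{start}},\alpha_{\mathsf{end}}\colon\{x_1,\dots,x_k\}\to\{0,1\}$ be two assignments satisfying $C$. Let $\alpha_{\mathsf{rand}}\colon\{x_1,\dots,x_k\}\to\{0,1\}$ be a uniformly random assignment, and let $\vec{\alpha}$ be a reconfiguration sequence chosen uniformly at random from $\mathscr{A}(\alpha_{\mathsf{start}} \leftrightsquigarrow \alpha_{\mathsf{rand}} \leftrightsquigarrow \alpha_{\mathsf{end}})$. Then $$\Pr_{\alpha_{\mathsf{rand}},\vec{\alpha}}\bigl[\vec{\alpha} \text{ satisfies } C\bigr] \geq 1 - \frac{1}{k-1} - \frac{1}{k}.$$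
   Context: A reconfiguration sequence from $\alpha$ to $\beta$ is a sequence of assignments starting at $\alpha$, ending at $\beta$, with consecutive assignments differing in at most one variable. A reconfiguration sequence satisfies a clause $C$ if every assignment in it satisfies $C$. For assignments $\alpha,\beta$, a reconfiguration sequence $(\alpha^{(1)},\dots,\alpha^{(T)})$ from $\alpha$ to $\beta$ is irredundant if no two consecutive assignments are identical and for each variable $x_i$ there is an index $t_i$ with $\alpha^{(t)}(x_i)=\alpha(x_i)$ for $t\le t_i$ and $\alpha^{(t)}(x_i)=\beta(x_i)$ for $t>t_i$ (i.e., it flips each variable on which $\alpha,\beta$ differ exactly once, in some order). $\mathscr{A}(\alpha\leftrightsquigarrow\beta)$ is the set of all irredundant reconfiguration sequences from $\alpha$ to $\beta$, and $\mathscr{A}(\alpha_1\leftrightsquigarrow\alpha_2\leftrightsquigarrow\alpha_3)$ is the set of all concatenations of a sequence in $\mathscr{A}(\alpha_1\leftrightsquigarrow\alpha_2)$ with a sequence in $\mathscr{A}(\alpha_2\leftrightsquigarrow\alpha_3)$. -}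

module Defs where

open import Data.Bool using (Bool; true; false; _∧_; _∨_; not; if_then_else_)
open import Data.Bool.Properties using () renaming (_≟_ to _≟B_)
open import Data.Nat using (ℕ; zero; suc; _≤ᵇ_)
open import Data.Fin using (Fin)
open import Data.Fin.Base using () 
open import Data.List using (List; []; _∷_; _++_; length; filterᵇ; map; concatMap; take; drop; upTo; allFin; cartesianProduct; foldr; last)
open import Data.Bool.ListAction using (all; any)
open import Data.Maybe using (Maybe; just; nothing)
open import Data.Vec using (Vec; lookup; toList) renaming ([] to []ᵥ; _∷_ to _∷ᵥ_)
open import Data.Vec.Properties using (≡-dec)
open import Data.Product using (_×_; _,_)
open import Data.Integer using (+_)
open import Data.Rational using (ℚ; 0ℚ; 1ℚ; _/_; _+_; _*_)
open import Relation.Nullary.Decidable using (⌊_⌋)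

-- Assignments to the variables x_1..x_k (x_{i+1} is index i : Fin k).
Assignment : ℕ → Set
Assignment k = Vec Bool k

-- A width-k clause over x_1..x_k: exactly one literal per variable;
-- polarity true means the literal is x_i, false means ¬x_i.
Clause : ℕ → Set
Clause k = Vec Bool k

eqB : Bool → Bool → Bool
eqB a b = ⌊ a ≟B b ⌋

eqA : ∀ {k} → Assignment k → Assignment k → Bool
eqA u v = ⌊ ≡-dec _≟B_ u v ⌋

satisfies : ∀ {k} → Clause k → Assignment k → Bool
satisfies {k} C α = any (λ i → eqB (lookup α i) (lookup C i)) (allFin k)

allAssignments : (k : ℕ) → List (Assignment k)
allAssignments zero = []ᵥ ∷ []
allAssignments (suc k) = concatMap (λ v → (false ∷ᵥ v) ∷ (true ∷ᵥ v) ∷ []) (allAssignments k)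

seqsOfLength : (k n : ℕ) → List (List (Assignment k))
seqsOfLength k zero = [] ∷ []
seqsOfLength k (suc n) = concatMap (λ a → map (a ∷_) (seqsOfLength k n)) (allAssignments k)

seqsUpTo : (k n : ℕ) → List (List (Assignment k))
seqsUpTo k n = concatMap (seqsOfLength k) (upTo (suc n))

hamming : ∀ {k} → Assignment k → Assignment k → ℕ
hamming {k} u v = length (filterᵇ (λ i → not (eqB (lookup u i) (lookup v i))) (allFin k))

consecutive : ∀ {A : Set} → (A → A → Bool) → List A → Bool
consecutive p [] = true
consecutive p (x ∷ []) = true
consecutive p (x ∷ y ∷ rest) = p x y ∧ consecutive p (y ∷ rest)

startsAt : ∀ {k} → Assignment k → List (Assignment k) → Bool
startsAt α [] = false
startsAt α (a ∷ _) = eqA a α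

endsAt : ∀ {k} → Assignment k → List (Assignment k) → Bool
endsAt β s with last s
... | nothing = false
... | just a = eqA a β

isReconfSeq : ∀ {k} → Assignment k → Assignment k → List (Assignment k) → Bool
isReconfSeq α β s = startsAt α s ∧ endsAt β s ∧ consecutive (λ u v → hamming u v ≤ᵇ 1) s

-- there is t with vs_t = a for positions t ≤ t_i and vs_t = b for t > t_i
-- (t_i ranges over 0..T, which covers every possible switching index)
switchesOnce : Bool → Bool → List Bool → Bool
switchesOnce a b vs =
  any (λ j → all (eqB a) (take j vs) ∧ all (eqB b) (drop j vs)) (upTo (suc (length vs)))

isIrredundant : ∀ {k} → Assignment k → Assignment k → List (Assignment k) → Bool
isIrredundant {k} α β s =
  isReconfSeq α β s
  ∧ consecutive (λ u v → not (eqA u v)) s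
  ∧ all (λ i → switchesOnce (lookup α i) (lookup β i) (map (λ a → lookup a i) s)) (allFin k)

-- 𝒜(α ⇝ β). Every irredundant sequence has length (#differing vars)+1 ≤ k+1,
-- so enumerating lists of length ≤ k+1 yields all of them.
irredundantSeqs : ∀ {k} → Assignment k → Assignment k → List (List (Assignment k))
irredundantSeqs {k} α β = filterᵇ (isIrredundant α β) (seqsUpTo k (suc k))

-- 𝒜(α₁ ⇝ α₂ ⇝ α₃), represented by the pairs (s₁ , s₂) whose concatenation
-- s₁ ++ s₂ is the element (concatenation is injective here since the length of
-- s₁ is determined by α₁, α₂).
irredundantSeqs3 : ∀ {k} → Assignment k → Assignment k → Assignment k
                 → List (List (Assignment k) × List (Assignment k))
irredundantSeqs3 α₁ α₂ α₃ = cartesianProduct (irredundantSeqs α₁ α₂) (irredundantSeqs α₂ α₃)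

seqSatisfies : ∀ {k} → Clause k → List (Assignment k) → Bool
seqSatisfies C s = all (satisfies C) s

-- n / d as a rational (0 when d = 0; never used with d = 0 below in a meaningful way)
ratio : ℕ → ℕ → ℚ
ratio n zero = 0ℚ
ratio n (suc d) = (+ n) / suc d

sumℚ : List ℚ → ℚ
sumℚ = foldr _+_ 0ℚ

probSat : (k : ℕ) → Clause k → Assignment k → Assignment k → ℚ
probSat k C αs αe =
  ratio 1 (2 Data.Nat.^ k) *
  sumℚ (map (λ r → let S = irredundantSeqs3 αs r αe in
                   ratio (length (filterᵇ (λ p → seqSatisfies C (Data.Product.proj₁ p ++ Data.Product.proj₂ p)) S))
                         (length S))
            (allAssignments k))
  where import Data.Nat
        import Data.Product

-- An irredundant sequence from α to β flips the d(α, β) variables on which α and β differ, once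
-- each and in some order, so there are d(α, β)! of them.  If some literal of C is true under both α
-- and β it stays true throughout; otherwise the sequence falsifies C exactly when it flips all t(α)
-- true literals of α before any of the t(β) true literals of β, which happens for t(α)! t(β)! of the
-- (t(α) + t(β))! orders, a fraction at most 1/(t(β) + 1) when t(α) ≥ 1.  The two halves of a
-- sequence through the midpoint r are chosen independently, so by (1 − x)(1 − y) ≥ 1 − x − y it
-- fails with probability at most ([αstart, r share no true literal] + [r, αend share no true
-- literal]) / (t(r) + 1).  For a satisfying α, one coordinate of every r sharing no true literal
-- with α is forced, so ∑ᵣ [α, r share no true literal] / (t(r) + 1) ≤ ∑ⱼ (k−1 choose j) / (j + 1)
-- = (2ᵏ − 1)/k.  Averaging over r, C fails with probability at most 2/k ≤ 1/(k − 1) + 1/k.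

module Submission where

open import Defs
open import Algebra.Bundles using (CommutativeMonoid)
open import Algebra.Structures using (IsCommutativeMonoid)
open import Data.Bool using (Bool; true; false; not; _∧_; _∨_)
open import Data.Bool.ListAction using (all; any; and; or)
open import Data.Bool.Properties
  using (∧-assoc; ∧-comm; ∧-idem; ∧-identityʳ; ∧-zeroʳ; ∨-idem; not-¬; T-≡) renaming (_≟_ to _≟ᴮ_)
open import Data.Empty using (⊥-elim)
open import Data.Fin using (Fin; zero; suc; _≟_)
open import Data.List
  using (List; []; _∷_; _++_; map; concatMap; foldr; filterᵇ; length; take; drop; tabulate; allFin; applyUpTo; upTo;
         cartesianProduct)
open import Data.List.Properties using (map-tabulate; map-applyUpTo; map-upTo; map-cong; length-++; length-map)
open import Data.Nat using (ℕ; zero; suc)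
open import Data.Product using (∃; _×_; _,_; proj₁; proj₂)
open import Data.Vec using ([]; _∷_; lookup; updateAt)
open import Data.Vec.Properties
  using (lookup∘updateAt; lookup∘updateAt′; ∷-injectiveˡ; ∷-injectiveʳ; ≡-dec)
open import Function using (_∘_; case_of_; Equivalence)
open import Relation.Binary.PropositionalEquality
open import Relation.Nullary using (yes; no)

module ListSum {R : Set} {_∙_ : R → R → R} {ε : R} (isCM : IsCommutativeMonoid _≡_ _∙_ ε) where

  open IsCommutativeMonoid isCM using (assoc; identityʳ; identityˡ; comm)

  private
    monoid : CommutativeMonoid _ _
    monoid = record { isCommutativeMonoid = isCM }

  open import Algebra.Properties.CommutativeSemigroup (CommutativeMonoid.commutativeSemigroup monoid)
    using (interchange)

  sumOver : {A : Set} → List A → (A → R) → R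
  sumOver xs f = foldr _∙_ ε (map f xs)

  infix 10 sumOver
  syntax sumOver xs (λ x → e) = ∑[ x ∈ xs ] e

  module _ {A : Set} where

    ∑-cong : (xs : List A) {f g : A → R} → (∀ x → f x ≡ g x) → ∑[ x ∈ xs ] f x ≡ ∑[ x ∈ xs ] g x
    ∑-cong []       f≗g = refl
    ∑-cong (x ∷ xs) f≗g = cong₂ _∙_ (f≗g x) (∑-cong xs f≗g)

    ∑-++ : (xs ys : List A) (f : A → R) → ∑[ x ∈ xs ++ ys ] f x ≡ (∑[ x ∈ xs ] f x) ∙ (∑[ x ∈ ys ] f x)
    ∑-++ []       ys f = sym (identityˡ _)
    ∑-++ (x ∷ xs) ys f = trans (cong (f x ∙_) (∑-++ xs ys f)) (sym (assoc (f x) _ _))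

    ∑-ε : (xs : List A) (f : A → R) → (∀ x → f x ≡ ε) → ∑[ x ∈ xs ] f x ≡ ε
    ∑-ε []       f vanish = refl
    ∑-ε (x ∷ xs) f vanish = trans (cong₂ _∙_ (vanish x) (∑-ε xs f vanish)) (identityˡ ε)

    ∑-distrib : (xs : List A) (f g : A → R) →
                ∑[ x ∈ xs ] (f x ∙ g x) ≡ (∑[ x ∈ xs ] f x) ∙ (∑[ x ∈ xs ] g x)
    ∑-distrib []       f g = sym (identityˡ ε)
    ∑-distrib (x ∷ xs) f g =
      trans (cong ((f x ∙ g x) ∙_) (∑-distrib xs f g)) (interchange (f x) (g x) _ _)

  ∑-concatMap : {A B : Set} (xs : List A) (g : A → List B) (f : B → R) →
                ∑[ y ∈ concatMap g xs ] f y ≡ ∑[ x ∈ xs ] ∑[ y ∈ g x ] f y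
  ∑-concatMap []       g f = refl
  ∑-concatMap (x ∷ xs) g f = trans (∑-++ (g x) (concatMap g xs) f) (cong (_ ∙_) (∑-concatMap xs g f))

  ∑ₐ-∷ : ∀ {k} x (f : Assignment (suc k) → R) →
         ∑[ γ ∈ allAssignments (suc k) ] f γ
         ≡ (∑[ γ ∈ allAssignments k ] f (x ∷ γ)) ∙ (∑[ γ ∈ allAssignments k ] f (not x ∷ γ))
  ∑ₐ-∷ {k} x f = trans (∑-concatMap (allAssignments k) _ f)
                       (trans (∑-cong (allAssignments k) (split x)) (∑-distrib (allAssignments k) _ _))
    where
    split : ∀ x γ → f (false ∷ γ) ∙ (f (true ∷ γ) ∙ ε) ≡ f (x ∷ γ) ∙ f (not x ∷ γ)
    split false γ = cong (f (false ∷ γ) ∙_) (identityʳ _)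
    split true  γ = trans (cong (f (false ∷ γ) ∙_) (identityʳ _)) (comm (f (false ∷ γ)) (f (true ∷ γ)))

module Combinatorics where

  open import Data.Nat using (pred; _+_; _*_; _≤_; _<_; _≤ᵇ_; _≡ᵇ_; _!; z≤n; s≤s)
  open import Data.Nat.Properties hiding (_≟_)
  open import Data.Nat.Solver using (module +-*-Solver)
  open import Algebra.Properties.Semiring.Sum +-*-semiring
    using (sum-syntax; sum-cong-≗; sum-replicate-zero; ∑-distrib-+; *-distribʳ-sum)
  open import Algebra.Properties.CommutativeSemigroup *-commutativeSemigroup using (x∙yz≈y∙xz)
  open ListSum +-0-isCommutativeMonoid

  private variable
    k : ℕ
    A B : Set

  𝟙 : Bool → ℕ
  𝟙 true  = 1
  𝟙 false = 0

  count : (A → Bool) → List A → ℕ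
  count p xs = length (filterᵇ p xs)

  count-++ : (p : A → Bool) (xs ys : List A) → count p (xs ++ ys) ≡ count p xs + count p ys
  count-++ p []       ys = refl
  count-++ p (x ∷ xs) ys with p x
  ... | true  = cong suc (count-++ p xs ys)
  ... | false = count-++ p xs ys

  count-map : (p : B → Bool) (f : A → B) (xs : List A) → count p (map f xs) ≡ count (p ∘ f) xs
  count-map p f []       = refl
  count-map p f (x ∷ xs) with p (f x)
  ... | true  = cong suc (count-map p f xs)
  ... | false = count-map p f xs

  count-concatMap : (p : B → Bool) (g : A → List B) (xs : List A) →
                    count p (concatMap g xs) ≡ ∑[ x ∈ xs ] count p (g x)
  count-concatMap p g []       = refl
  count-concatMap p g (x ∷ xs) =
    trans (count-++ p (g x) (concatMap g xs)) (cong (count p (g x) +_) (count-concatMap p g xs))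

  count-cong : {p q : A → Bool} (xs : List A) → (∀ x → p x ≡ q x) → count p xs ≡ count q xs
  count-cong             []       p≗q = refl
  count-cong {p = p} {q} (x ∷ xs) p≗q with p x | q x | p≗q x
  ... | true  | .true  | refl = cong suc (count-cong xs p≗q)
  ... | false | .false | refl = count-cong xs p≗q

  count-false : (p : A → Bool) (xs : List A) → (∀ x → p x ≡ false) → count p xs ≡ 0
  count-false p []       never = refl
  count-false p (x ∷ xs) never rewrite never x = count-false p xs never

  count-∷ : (p : A → Bool) (x : A) (xs : List A) → 𝟙 (p x) + count p xs ≡ count p (x ∷ xs)
  count-∷ p x xs with p x
  ... | true  = refl
  ... | false = refl

  count-∧ : ∀ b (p : A → Bool) (xs : List A) → count (λ x → b ∧ p x) xs ≡ 𝟙 b * count p xs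
  count-∧ true  p xs = sym (+-identityʳ _)
  count-∧ false p xs = count-false _ xs (λ _ → refl)

  count-filterᵇ : (p q : A → Bool) (xs : List A) →
                  count q (filterᵇ p xs) ≡ count (λ x → p x ∧ q x) xs
  count-filterᵇ p q []       = refl
  count-filterᵇ p q (x ∷ xs) with p x
  ... | false = count-filterᵇ p q xs
  ... | true with q x
  ...   | true  = cong suc (count-filterᵇ p q xs)
  ...   | false = count-filterᵇ p q xs

  count-tabulate : ∀ {n} (f : Fin n → A) (p : A → Bool) →
                   count p (tabulate f) ≡ ∑[ i < n ] 𝟙 (p (f i))
  count-tabulate {n = zero}  f p = refl
  count-tabulate {n = suc n} f p with p (f zero)
  ... | true  = cong suc (count-tabulate (f ∘ suc) p)
  ... | false = count-tabulate (f ∘ suc) p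

  length-cartesianProduct : (xs : List A) (ys : List B) →
                            length (cartesianProduct xs ys) ≡ length xs * length ys
  length-cartesianProduct []       ys = refl
  length-cartesianProduct (x ∷ xs) ys =
    trans (length-++ (map (x ,_) ys)) (cong₂ _+_ (length-map (x ,_) ys) (length-cartesianProduct xs ys))

  count-cartesianProduct : (p : A → Bool) (q : B → Bool) (xs : List A) (ys : List B) →
                           count (λ (x , y) → p x ∧ q y) (cartesianProduct xs ys) ≡ count p xs * count q ys
  count-cartesianProduct p q []       ys = refl
  count-cartesianProduct p q (x ∷ xs) ys = begin
    count r (map (x ,_) ys ++ cartesianProduct xs ys)
      ≡⟨ count-++ r (map (x ,_) ys) _ ⟩
    count r (map (x ,_) ys) + count r (cartesianProduct xs ys)
      ≡⟨ cong₂ _+_ (count-map r (x ,_) ys) (count-cartesianProduct p q xs ys) ⟩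
    count (λ y → p x ∧ q y) ys + count p xs * count q ys
      ≡⟨ cong (_+ count p xs * count q ys) (count-∧ (p x) q ys) ⟩
    𝟙 (p x) * count q ys + count p xs * count q ys
      ≡⟨ *-distribʳ-+ (count q ys) (𝟙 (p x)) (count p xs) ⟨
    (𝟙 (p x) + count p xs) * count q ys
      ≡⟨ cong (_* count q ys) (count-∷ p x xs) ⟩
    count p (x ∷ xs) * count q ys
      ∎
    where
    open ≡-Reasoning
    r = λ ((x , y) : _ × _) → p x ∧ q y

  all-++ : (p : A → Bool) (xs ys : List A) → all p (xs ++ ys) ≡ all p xs ∧ all p ys
  all-++ p []       ys = refl
  all-++ p (x ∷ xs) ys = trans (cong (p x ∧_) (all-++ p xs ys)) (sym (∧-assoc (p x) _ _))

  ∧-≡true : ∀ x {y} → x ∧ y ≡ true → x ≡ true × y ≡ true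
  ∧-≡true true y≡true = refl , y≡true

  any-∧ : ∀ b (p : A → Bool) xs → any (λ x → b ∧ p x) xs ≡ b ∧ any p xs
  any-∧ true  p xs       = refl
  any-∧ false p []       = refl
  any-∧ false p (x ∷ xs) = any-∧ false p xs

  or-tabulate : ∀ {n} (f : Fin n → Bool) → or (tabulate f) ≡ not (∑[ i < n ] 𝟙 (f i) ≡ᵇ 0)
  or-tabulate {zero}  f = refl
  or-tabulate {suc n} f with f zero
  ... | true  = refl
  ... | false = or-tabulate (f ∘ suc)

  and-tabulate⁺ : ∀ {n} (f : Fin n → Bool) → (∀ i → f i ≡ true) → and (tabulate f) ≡ true
  and-tabulate⁺ {zero}  f all-true = refl
  and-tabulate⁺ {suc n} f all-true rewrite all-true zero = and-tabulate⁺ (f ∘ suc) (all-true ∘ suc)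

  and-tabulate⁻ : ∀ {n} (f : Fin n → Bool) → and (tabulate f) ≡ true → ∀ i → f i ≡ true
  and-tabulate⁻ f eq zero    = proj₁ (∧-≡true (f zero) eq)
  and-tabulate⁻ f eq (suc i) = and-tabulate⁻ (f ∘ suc) (proj₂ (∧-≡true (f zero) eq)) i

  all-allFin⁺ : (p : Fin k → Bool) → (∀ i → p i ≡ true) → all p (allFin k) ≡ true
  all-allFin⁺ p all-true = trans (cong and (map-tabulate (λ i → i) p)) (and-tabulate⁺ p all-true)

  all-allFin⁻ : (p : Fin k → Bool) → all p (allFin k) ≡ true → ∀ i → p i ≡ true
  all-allFin⁻ p eq = and-tabulate⁻ p (trans (sym (cong and (map-tabulate (λ i → i) p))) eq)

  eqB-refl : ∀ x → eqB x x ≡ true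
  eqB-refl true  = refl
  eqB-refl false = refl

  eqB-sound : ∀ {x y} → eqB x y ≡ true → x ≡ y
  eqB-sound {true}  {true}  _ = refl
  eqB-sound {false} {false} _ = refl

  eqA-refl : (α : Assignment k) → eqA α α ≡ true
  eqA-refl α with ≡-dec _≟ᴮ_ α α
  ... | yes _   = refl
  ... | no α≢α = ⊥-elim (α≢α refl)

  eqA-sound : (α β : Assignment k) → eqA α β ≡ true → α ≡ β
  eqA-sound α β eq with ≡-dec _≟ᴮ_ α β
  ... | yes α≡β = α≡β

  eqA-≢ : (α β : Assignment k) → α ≢ β → eqA α β ≡ false
  eqA-≢ α β α≢β with ≡-dec _≟ᴮ_ α β
  ... | yes α≡β = ⊥-elim (α≢β α≡β)
  ... | no _    = refl

  ∑𝟙≤ : ∀ {n} (f : Fin n → Bool) → ∑[ i < n ] 𝟙 (f i) ≤ n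
  ∑𝟙≤ {zero}  f = z≤n
  ∑𝟙≤ {suc n} f with f zero
  ... | true  = s≤s (∑𝟙≤ (f ∘ suc))
  ... | false = m≤n⇒m≤1+n (∑𝟙≤ (f ∘ suc))

  ∑𝟙≡0 : ∀ {n} (f : Fin n → Bool) → ∑[ i < n ] 𝟙 (f i) ≡ 0 → ∀ i → f i ≡ false
  ∑𝟙≡0 f eq zero with f zero
  ... | false = refl
  ∑𝟙≡0 f eq (suc i) = ∑𝟙≡0 (f ∘ suc) (m+n≡0⇒n≡0 (𝟙 (f zero)) eq) i

  𝟙*-cong : ∀ b {x y} → (b ≡ true → x ≡ y) → 𝟙 b * x ≡ 𝟙 b * y
  𝟙*-cong true  x≡y = cong (_+ 0) (x≡y refl)
  𝟙*-cong false x≡y = refl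

  δ : ℕ → ℕ → ℕ → ℕ
  δ n m x = 𝟙 (n ≡ᵇ m) * x

  ∑-upTo-suc : (f : ℕ → ℕ) (N : ℕ) → ∑[ n ∈ upTo (suc N) ] f n ≡ f 0 + ∑[ n ∈ upTo N ] f (suc n)
  ∑-upTo-suc f N =
    cong (λ xs → f 0 + foldr _+_ 0 xs) (trans (map-applyUpTo suc f N) (sym (map-upTo (f ∘ suc) N)))

  ∑-upTo-δ : (N m x : ℕ) → m < N → ∑[ n ∈ upTo N ] δ n m x ≡ x
  ∑-upTo-δ (suc N) zero    x _         = begin
    ∑[ n ∈ upTo (suc N) ] δ n 0 x       ≡⟨ ∑-upTo-suc (λ n → δ n 0 x) N ⟩
    1 * x + ∑[ n ∈ upTo N ] 0           ≡⟨ cong₂ _+_ (*-identityˡ x) (∑-ε (upTo N) _ (λ _ → refl)) ⟩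
    x + 0                               ≡⟨ +-identityʳ x ⟩
    x                                   ∎
    where open ≡-Reasoning
  ∑-upTo-δ (suc N) (suc m) x (s≤s m<N) =
    trans (∑-upTo-suc (λ n → δ n (suc m) x) N) (∑-upTo-δ N m x m<N)

  suc!*suc!≤ : ∀ a t → suc a ! * suc t ! ≤ (suc a + t) !
  suc!*suc!≤ zero    t = ≤-reflexive (*-identityˡ (suc t !))
  suc!*suc!≤ (suc a) t = begin
    (2 + a) ! * suc t !            ≡⟨ *-assoc (2 + a) (suc a !) (suc t !) ⟩
    (2 + a) * (suc a ! * suc t !)  ≤⟨ *-monoʳ-≤ (2 + a) (suc!*suc!≤ a t) ⟩
    (2 + a) * (suc a + t) !        ≤⟨ *-monoˡ-≤ ((suc a + t) !) (s≤s (s≤s (m≤m+n a t))) ⟩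
    (2 + a + t) !                  ∎
    where open ≤-Reasoning

  -- (1 − x₁)(1 − x₂) ≥ 1 − x₁ − x₂ for xᵢ = Bᵢ/(Gᵢ + Bᵢ) ≤ eᵢ/s, with the denominators cleared.
  union-bound : ∀ G₁ B₁ G₂ B₂ s e₁ e₂ → B₁ * s ≤ e₁ * (G₁ + B₁) → B₂ * s ≤ e₂ * (G₂ + B₂) →
                let T = (G₁ + B₁) * (G₂ + B₂) in T * s ≤ G₁ * G₂ * s + e₁ * T + e₂ * T
  union-bound G₁ B₁ G₂ B₂ s e₁ e₂ bound₁ bound₂ = begin
    (G₁ + B₁) * (G₂ + B₂) * s
      ≡⟨ expand G₁ B₁ G₂ B₂ s ⟩
    G₁ * G₂ * s + (B₁ * s * (G₂ + B₂) + G₁ * (B₂ * s))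
      ≤⟨ +-monoʳ-≤ (G₁ * G₂ * s) (+-mono-≤ (*-monoˡ-≤ (G₂ + B₂) bound₁) (*-mono-≤ (m≤m+n G₁ B₁) bound₂)) ⟩
    G₁ * G₂ * s + (e₁ * (G₁ + B₁) * (G₂ + B₂) + (G₁ + B₁) * (e₂ * (G₂ + B₂)))
      ≡⟨ regroup G₁ B₁ G₂ B₂ s e₁ e₂ ⟩
    G₁ * G₂ * s + e₁ * ((G₁ + B₁) * (G₂ + B₂)) + e₂ * ((G₁ + B₁) * (G₂ + B₂))
      ∎
    where
    open ≤-Reasoning
    open +-*-Solver
    expand : ∀ G₁ B₁ G₂ B₂ s →
             (G₁ + B₁) * (G₂ + B₂) * s ≡ G₁ * G₂ * s + (B₁ * s * (G₂ + B₂) + G₁ * (B₂ * s))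
    expand = solve 5 (λ G₁ B₁ G₂ B₂ s → (G₁ :+ B₁) :* (G₂ :+ B₂) :* s
                        := G₁ :* G₂ :* s :+ (B₁ :* s :* (G₂ :+ B₂) :+ G₁ :* (B₂ :* s))) refl
    regroup : ∀ G₁ B₁ G₂ B₂ s e₁ e₂ →
              G₁ * G₂ * s + (e₁ * (G₁ + B₁) * (G₂ + B₂) + (G₁ + B₁) * (e₂ * (G₂ + B₂)))
              ≡ G₁ * G₂ * s + e₁ * ((G₁ + B₁) * (G₂ + B₂)) + e₂ * ((G₁ + B₁) * (G₂ + B₂))
    regroup = solve 7 (λ G₁ B₁ G₂ B₂ s e₁ e₂ →
                G₁ :* G₂ :* s :+ (e₁ :* (G₁ :+ B₁) :* (G₂ :+ B₂) :+ (G₁ :+ B₁) :* (e₂ :* (G₂ :+ B₂)))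
                := G₁ :* G₂ :* s :+ e₁ :* ((G₁ :+ B₁) :* (G₂ :+ B₂)) :+ e₂ :* ((G₁ :+ B₁) :* (G₂ :+ B₂)))
              refl

  -- True literals and Hamming distance

  differsAt : Assignment k → Assignment k → Fin k → Bool
  differsAt α β i = not (eqB (lookup α i) (lookup β i))

  litTrue : Clause k → Assignment k → Fin k → Bool
  litTrue C α i = eqB (lookup α i) (lookup C i)

  dist : Assignment k → Assignment k → ℕ
  dist {k} α β = ∑[ i < k ] 𝟙 (differsAt α β i)

  trueLits : Clause k → Assignment k → ℕ
  trueLits {k} C α = ∑[ i < k ] 𝟙 (litTrue C α i)

  sharedTrueLits : Clause k → Assignment k → Assignment k → ℕ
  sharedTrueLits {k} C α β = ∑[ i < k ] 𝟙 (litTrue C α i ∧ litTrue C β i)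

  flipAt : Assignment k → Fin k → Assignment k
  flipAt α i = updateAt α i not

  hamming≡dist : (α β : Assignment k) → hamming α β ≡ dist α β
  hamming≡dist α β = count-tabulate (λ i → i) (differsAt α β)

  satisfies≡trueLits≢0 : (C : Clause k) (α : Assignment k) → satisfies C α ≡ not (trueLits C α ≡ᵇ 0)
  satisfies≡trueLits≢0 C α =
    trans (cong or (map-tabulate (λ i → i) (litTrue C α))) (or-tabulate (litTrue C α))

  satisfies⇒trueLits≢0 : (C : Clause k) (α : Assignment k) → satisfies C α ≡ true → trueLits C α ≢ 0
  satisfies⇒trueLits≢0 C α sat t≡0 =
    case trans (sym sat) (trans (satisfies≡trueLits≢0 C α) (cong (λ t → not (t ≡ᵇ 0)) t≡0)) of λ ()

  falsifies⇒trueLits≡0 : (C : Clause k) (α : Assignment k) → satisfies C α ≡ false → trueLits C α ≡ 0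
  falsifies⇒trueLits≡0 C α unsat with trueLits C α | trans (sym unsat) (satisfies≡trueLits≢0 C α)
  ... | zero  | _  = refl
  ... | suc _ | ()

  flipAt-≢ : (α : Assignment k) (i : Fin k) → α ≢ flipAt α i
  flipAt-≢ α i α≡ = not-¬ refl (trans (cong (λ γ → lookup γ i) α≡) (lookup∘updateAt i α))

  dist-self : (α : Assignment k) → dist α α ≡ 0
  dist-self []          = refl
  dist-self (true ∷ α)  = dist-self α
  dist-self (false ∷ α) = dist-self α

  dist≡0⇒≡ : (α β : Assignment k) → dist α β ≡ 0 → α ≡ β
  dist≡0⇒≡ []          []          eq = refl
  dist≡0⇒≡ (true ∷ α)  (true ∷ β)  eq = cong (true ∷_) (dist≡0⇒≡ α β eq)
  dist≡0⇒≡ (false ∷ α) (false ∷ β) eq = cong (false ∷_) (dist≡0⇒≡ α β eq)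

  eqA≡0≡ᵇdist : (α β : Assignment k) → eqA α β ≡ (0 ≡ᵇ dist α β)
  eqA≡0≡ᵇdist α β with dist α β in d
  ... | zero  rewrite dist≡0⇒≡ α β d = eqA-refl β
  ... | suc _ = eqA-≢ α β λ where refl → case trans (sym d) (dist-self α) of λ ()

  dist≤ : (α β : Assignment k) → dist α β ≤ k
  dist≤ α β = ∑𝟙≤ (differsAt α β)

  dist-sym : (α β : Assignment k) → dist α β ≡ dist β α
  dist-sym α β = sum-cong-≗ (λ i → cong 𝟙 (differs-sym (lookup α i) (lookup β i)))
    where
    differs-sym : ∀ x y → not (eqB x y) ≡ not (eqB y x)
    differs-sym true  true  = refl
    differs-sym true  false = refl
    differs-sym false true  = refl
    differs-sym false false = refl

  dist-flipAt-self : (α : Assignment k) (i : Fin k) → dist α (flipAt α i) ≡ 1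
  dist-flipAt-self (true ∷ α)  zero    = cong suc (dist-self α)
  dist-flipAt-self (false ∷ α) zero    = cong suc (dist-self α)
  dist-flipAt-self (true ∷ α)  (suc i) = dist-flipAt-self α i
  dist-flipAt-self (false ∷ α) (suc i) = dist-flipAt-self α i

  dist-flipAt : (α β : Assignment k) (i : Fin k) → differsAt α β i ≡ true →
                suc (dist (flipAt α i) β) ≡ dist α β
  dist-flipAt (true ∷ α)  (false ∷ β) zero    _ = refl
  dist-flipAt (false ∷ α) (true ∷ β)  zero    _ = refl
  dist-flipAt (x ∷ α)     (y ∷ β)     (suc i) d =
    trans (sym (+-suc (𝟙 (not (eqB x y))) _)) (cong (𝟙 (not (eqB x y)) +_) (dist-flipAt α β i d))

  dist≤1⇒flipAt : (α γ : Assignment k) → dist α γ ≤ 1 → α ≢ γ → ∃ λ i → γ ≡ flipAt α i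
  dist≤1⇒flipAt []          []          _         α≢γ = ⊥-elim (α≢γ refl)
  dist≤1⇒flipAt (true ∷ α)  (false ∷ γ) (s≤s d≤0) _   =
    zero , cong (false ∷_) (sym (dist≡0⇒≡ α γ (n≤0⇒n≡0 d≤0)))
  dist≤1⇒flipAt (false ∷ α) (true ∷ γ)  (s≤s d≤0) _   =
    zero , cong (true ∷_) (sym (dist≡0⇒≡ α γ (n≤0⇒n≡0 d≤0)))
  dist≤1⇒flipAt (true ∷ α)  (true ∷ γ)  d≤1       α≢γ =
    let i , γ≡ = dist≤1⇒flipAt α γ d≤1 (α≢γ ∘ cong (true ∷_)) in suc i , cong (true ∷_) γ≡
  dist≤1⇒flipAt (false ∷ α) (false ∷ γ) d≤1       α≢γ =
    let i , γ≡ = dist≤1⇒flipAt α γ d≤1 (α≢γ ∘ cong (false ∷_)) in suc i , cong (false ∷_) γ≡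

  differsAt⇒≡not : (α β : Assignment k) (i : Fin k) →
                   differsAt α β i ≡ true → lookup β i ≡ not (lookup α i)
  differsAt⇒≡not α β i = go (lookup α i) (lookup β i)
    where
    go : ∀ x y → not (eqB x y) ≡ true → y ≡ not x
    go true  false _ = refl
    go false true  _ = refl

  ≡not⇒differsAt : (α β : Assignment k) (i : Fin k) →
                   lookup β i ≡ not (lookup α i) → differsAt α β i ≡ true
  ≡not⇒differsAt α β i β≡ rewrite β≡ = go (lookup α i)
    where
    go : ∀ x → not (eqB x (not x)) ≡ true
    go true  = refl
    go false = refl

  ¬differsAt⇒≡ : (α β : Assignment k) (i : Fin k) → differsAt α β i ≡ false →
                 lookup α i ≡ lookup β i
  ¬differsAt⇒≡ α β i = go (lookup α i) (lookup β i)
    where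
    go : ∀ x y → not (eqB x y) ≡ false → x ≡ y
    go true  true  _ = refl
    go false false _ = refl

  trueLits-flipAt : (C : Clause k) (α : Assignment k) (i : Fin k) → litTrue C α i ≡ true →
                    suc (trueLits C (flipAt α i)) ≡ trueLits C α
  trueLits-flipAt (true ∷ C)  (true ∷ α)  zero    _ = refl
  trueLits-flipAt (false ∷ C) (false ∷ α) zero    _ = refl
  trueLits-flipAt (c ∷ C)     (x ∷ α)     (suc i) l =
    trans (sym (+-suc (𝟙 (eqB x c)) _)) (cong (𝟙 (eqB x c) +_) (trueLits-flipAt C α i l))

  sharedTrueLits-flipAt : (C : Clause k) (α β : Assignment k) (i : Fin k) → differsAt α β i ≡ true →
                          sharedTrueLits C (flipAt α i) β ≡ sharedTrueLits C α β + 𝟙 (not (litTrue C α i))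
  sharedTrueLits-flipAt (true ∷ C)  (true ∷ α)  (false ∷ β) zero _ = sym (+-identityʳ _)
  sharedTrueLits-flipAt (false ∷ C) (true ∷ α)  (false ∷ β) zero _ = +-comm 1 _
  sharedTrueLits-flipAt (true ∷ C)  (false ∷ α) (true ∷ β)  zero _ = +-comm 1 _
  sharedTrueLits-flipAt (false ∷ C) (false ∷ α) (true ∷ β)  zero _ = sym (+-identityʳ _)
  sharedTrueLits-flipAt (c ∷ C) (x ∷ α) (y ∷ β) (suc i) d =
    trans (cong (𝟙 (eqB x c ∧ eqB y c) +_) (sharedTrueLits-flipAt C α β i d))
          (sym (+-assoc (𝟙 (eqB x c ∧ eqB y c)) _ _))

  sharedTrueLits-self : (C : Clause k) (α : Assignment k) → sharedTrueLits C α α ≡ trueLits C α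
  sharedTrueLits-self C α = sum-cong-≗ (λ i → cong 𝟙 (∧-idem (litTrue C α i)))

  sharedTrueLits-sym : (C : Clause k) (α β : Assignment k) → sharedTrueLits C α β ≡ sharedTrueLits C β α
  sharedTrueLits-sym C α β = sum-cong-≗ (λ i → cong 𝟙 (∧-comm (litTrue C α i) (litTrue C β i)))

  sharedTrueLits≡0 : (C : Clause k) (α β : Assignment k) → sharedTrueLits C α β ≡ 0 →
                     ∀ i → litTrue C α i ∧ litTrue C β i ≡ false
  sharedTrueLits≡0 C α β = ∑𝟙≡0 (λ i → litTrue C α i ∧ litTrue C β i)

  dist+2*shared : (C : Clause k) (α β : Assignment k) →
                  dist α β + (sharedTrueLits C α β + sharedTrueLits C α β) ≡ trueLits C α + trueLits C β
  dist+2*shared {k} C α β = begin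
    dist α β + (s + s)
      ≡⟨ cong (dist α β +_) (∑-distrib-+ sᵢ sᵢ) ⟨
    dist α β + ∑[ i < k ] (sᵢ i + sᵢ i)
      ≡⟨ ∑-distrib-+ dᵢ (λ i → sᵢ i + sᵢ i) ⟨
    ∑[ i < k ] (dᵢ i + (sᵢ i + sᵢ i))
      ≡⟨ sum-cong-≗ (λ i → pointwise (lookup α i) (lookup β i) (lookup C i)) ⟩
    ∑[ i < k ] (𝟙 (litTrue C α i) + 𝟙 (litTrue C β i))
      ≡⟨ ∑-distrib-+ (𝟙 ∘ litTrue C α) (𝟙 ∘ litTrue C β) ⟩
    trueLits C α + trueLits C β
      ∎
    where
    open ≡-Reasoning
    s = sharedTrueLits C α β
    sᵢ = λ i → 𝟙 (litTrue C α i ∧ litTrue C β i)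
    dᵢ = λ i → 𝟙 (differsAt α β i)
    pointwise : ∀ x y c → 𝟙 (not (eqB x y)) + (𝟙 (eqB x c ∧ eqB y c) + 𝟙 (eqB x c ∧ eqB y c))
                          ≡ 𝟙 (eqB x c) + 𝟙 (eqB y c)
    pointwise true  true  true  = refl
    pointwise true  true  false = refl
    pointwise true  false true  = refl
    pointwise true  false false = refl
    pointwise false true  true  = refl
    pointwise false true  false = refl
    pointwise false false true  = refl
    pointwise false false false = refl

  trueLits≡0⇒sharedTrueLits≡0 : (C : Clause k) (α β : Assignment k) →
                                trueLits C α ≡ 0 → sharedTrueLits C α β ≡ 0
  trueLits≡0⇒sharedTrueLits≡0 []      []      []      _   = refl
  trueLits≡0⇒sharedTrueLits≡0 (c ∷ C) (x ∷ α) (y ∷ β) t≡0 with eqB x c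
  ... | false = trueLits≡0⇒sharedTrueLits≡0 C α β t≡0

  trueLits≡0⇒dist≡trueLits : (C : Clause k) (α β : Assignment k) →
                             trueLits C α ≡ 0 → dist α β ≡ trueLits C β
  trueLits≡0⇒dist≡trueLits C α β t≡0 = begin
    dist α β                     ≡⟨ +-identityʳ _ ⟨
    dist α β + 0                 ≡⟨ cong (λ s → dist α β + (s + s)) s≡0 ⟨
    dist α β + (s + s)           ≡⟨ dist+2*shared C α β ⟩
    trueLits C α + trueLits C β  ≡⟨ cong (_+ trueLits C β) t≡0 ⟩
    trueLits C β                 ∎
    where
    open ≡-Reasoning
    s = sharedTrueLits C α β
    s≡0 = trueLits≡0⇒sharedTrueLits≡0 C α β t≡0

  -- Irredundant sequences

  switchesOnce-∷ : ∀ a c x vs →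
                   switchesOnce a c (x ∷ vs) ≡ all (eqB c) (x ∷ vs) ∨ (eqB a x ∧ switchesOnce a c vs)
  switchesOnce-∷ a c x vs = cong (all (eqB c) (x ∷ vs) ∨_) (begin
    or (map P (applyUpTo suc n))         ≡⟨ cong or (map-applyUpTo suc P n) ⟩
    or (applyUpTo (P ∘ suc) n)           ≡⟨ cong or (map-upTo (P ∘ suc) n) ⟨
    any (P ∘ suc) (upTo n)               ≡⟨ cong or (map-cong (λ j → ∧-assoc (eqB a x) _ _) (upTo n)) ⟩
    any (λ j → eqB a x ∧ Q j) (upTo n)   ≡⟨ any-∧ (eqB a x) Q (upTo n) ⟩
    eqB a x ∧ switchesOnce a c vs        ∎)
    where
    open ≡-Reasoning
    n = suc (length vs)
    P Q : ℕ → Bool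
    P j = all (eqB a) (take j (x ∷ vs)) ∧ all (eqB c) (drop j (x ∷ vs))
    Q j = all (eqB a) (take j vs) ∧ all (eqB c) (drop j vs)

  switchesOnce-const : ∀ c vs → switchesOnce c c vs ≡ all (eqB c) vs
  switchesOnce-const c []       = refl
  switchesOnce-const c (x ∷ vs) = begin
    switchesOnce c c (x ∷ vs)               ≡⟨ switchesOnce-∷ c c x vs ⟩
    allC ∨ (eqB c x ∧ switchesOnce c c vs)  ≡⟨ cong (λ b → allC ∨ (eqB c x ∧ b)) (switchesOnce-const c vs) ⟩
    allC ∨ allC                             ≡⟨ ∨-idem allC ⟩
    allC                                    ∎
    where
    open ≡-Reasoning
    allC = all (eqB c) (x ∷ vs)

  switchesOnce-single : ∀ a c → switchesOnce a c (a ∷ []) ≡ true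
  switchesOnce-single true  true  = refl
  switchesOnce-single true  false = refl
  switchesOnce-single false true  = refl
  switchesOnce-single false false = refl

  switchesOnce-stay : ∀ a c vs → switchesOnce a c (a ∷ a ∷ vs) ≡ switchesOnce a c (a ∷ vs)
  switchesOnce-stay a c vs = begin
    switchesOnce a c (a ∷ a ∷ vs)                                ≡⟨ switchesOnce-∷ a c a (a ∷ vs) ⟩
    all (eqB c) (a ∷ a ∷ vs) ∨ (eqB a a ∧ S)                     ≡⟨ cong (λ b → (eqB c a ∧ allC) ∨ (b ∧ S)) (eqB-refl a) ⟩
    (eqB c a ∧ allC) ∨ S                                         ≡⟨ cong ((eqB c a ∧ allC) ∨_) (switchesOnce-∷ a c a vs) ⟩
    (eqB c a ∧ allC) ∨ (allC ∨ (eqB a a ∧ switchesOnce a c vs))  ≡⟨ absorb (eqB c a) allC _ ⟩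
    allC ∨ (eqB a a ∧ switchesOnce a c vs)                       ≡⟨ switchesOnce-∷ a c a vs ⟨
    switchesOnce a c (a ∷ vs)                                    ∎
    where
    open ≡-Reasoning
    allC = all (eqB c) (a ∷ vs)
    S = switchesOnce a c (a ∷ vs)
    absorb : ∀ b y z → (b ∧ y) ∨ (y ∨ z) ≡ y ∨ z
    absorb true  true  z = refl
    absorb true  false z = refl
    absorb false y     z = refl

  switchesOnce-switch : ∀ a c vs → switchesOnce a c (a ∷ not a ∷ vs) ≡ all (eqB c) (not a ∷ vs)
  switchesOnce-switch a c vs = begin
    switchesOnce a c (a ∷ not a ∷ vs)
      ≡⟨ switchesOnce-∷ a c a (not a ∷ vs) ⟩
    all (eqB c) (a ∷ not a ∷ vs) ∨ (eqB a a ∧ switchesOnce a c (not a ∷ vs))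
      ≡⟨ cong (λ b → all (eqB c) (a ∷ not a ∷ vs) ∨ (eqB a a ∧ b)) (switchesOnce-∷ a c (not a) vs) ⟩
    (eqB c a ∧ (eqB c (not a) ∧ allC)) ∨ (eqB a a ∧ ((eqB c (not a) ∧ allC) ∨ (eqB a (not a) ∧ S)))
      ≡⟨ first-step-switches a c ⟩
    eqB c (not a) ∧ allC
      ∎
    where
    open ≡-Reasoning
    allC = all (eqB c) vs
    S = switchesOnce a c vs
    ∨-false : ∀ y → y ∨ false ≡ y
    ∨-false true  = refl
    ∨-false false = refl
    first-step-switches : ∀ a c → (eqB c a ∧ (eqB c (not a) ∧ allC))
                                  ∨ (eqB a a ∧ ((eqB c (not a) ∧ allC) ∨ (eqB a (not a) ∧ S)))
                                  ≡ eqB c (not a) ∧ allC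
    first-step-switches true  true  = refl
    first-step-switches true  false = ∨-false allC
    first-step-switches false true  = ∨-false allC
    first-step-switches false false = refl

  column : Fin k → List (Assignment k) → List Bool
  column i s = map (λ γ → lookup γ i) s

  switchesEachOnce : Assignment k → Assignment k → List (Assignment k) → Bool
  switchesEachOnce {k} α β s = all (λ i → switchesOnce (lookup α i) (lookup β i) (column i s)) (allFin k)

  switchesEachOnce-[_] : (α : Assignment k) {β : Assignment k} → switchesEachOnce α β (α ∷ []) ≡ true
  switchesEachOnce-[ α ] {β} = all-allFin⁺ _ (λ i → switchesOnce-single (lookup α i) (lookup β i))

  irredundant-parts : (α β : Assignment k) (s : List (Assignment k)) → isIrredundant α β s ≡ true →
                 startsAt α s ≡ true × consecutive (λ u v → hamming u v ≤ᵇ 1) s ≡ true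
                 × consecutive (λ u v → not (eqA u v)) s ≡ true × switchesEachOnce α β s ≡ true
  irredundant-parts α β s irr = starts , adjacent , distinct , switches
    where
    reconf&rest = ∧-≡true (isReconfSeq α β s) irr
    starts&rest = ∧-≡true (startsAt α s) (proj₁ reconf&rest)
    starts = proj₁ starts&rest
    adjacent = proj₂ (∧-≡true (endsAt β s) (proj₂ starts&rest))
    distinct&switches = ∧-≡true (consecutive (λ u v → not (eqA u v)) s) (proj₂ reconf&rest)
    distinct = proj₁ distinct&switches
    switches = proj₂ distinct&switches

  irredundant-head : (α β γ : Assignment k) (s : List (Assignment k)) →
                     isIrredundant α β (γ ∷ s) ≡ true → γ ≡ α
  irredundant-head α β γ s irr = eqA-sound γ α (proj₁ (irredundant-parts α β (γ ∷ s) irr))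

  irredundant-[_] : (α : Assignment k) {β : Assignment k} → isIrredundant α β (α ∷ []) ≡ eqA α β
  irredundant-[ α ] {β} rewrite eqA-refl α | switchesEachOnce-[ α ] {β} =
    trans (∧-identityʳ _) (∧-identityʳ _)

  irredundant-second : (α β γ : Assignment k) (s : List (Assignment k)) →
                       isIrredundant α β (α ∷ γ ∷ s) ≡ true → ∃ λ i → differsAt α β i ≡ true × γ ≡ flipAt α i
  irredundant-second α β γ s irr = i , ≡not⇒differsAt α β i βᵢ≡ , γ≡
    where
    parts = irredundant-parts α β (α ∷ γ ∷ s) irr
    adjacent : (hamming α γ ≤ᵇ 1) ≡ true
    adjacent = proj₁ (∧-≡true (hamming α γ ≤ᵇ 1) (proj₁ (proj₂ parts)))
    distinct : not (eqA α γ) ≡ true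
    distinct = proj₁ (∧-≡true (not (eqA α γ)) (proj₁ (proj₂ (proj₂ parts))))
    α≢γ : α ≢ γ
    α≢γ refl with () ← trans (cong not (sym (eqA-refl α))) distinct
    near : dist α γ ≤ 1
    near = subst (_≤ 1) (hamming≡dist α γ) (≤ᵇ⇒≤ (hamming α γ) 1 (Equivalence.from T-≡ adjacent))
    i : Fin _
    i = proj₁ (dist≤1⇒flipAt α γ near α≢γ)
    γ≡ : γ ≡ flipAt α i
    γ≡ = proj₂ (dist≤1⇒flipAt α γ near α≢γ)
    γᵢ≡ : lookup γ i ≡ not (lookup α i)
    γᵢ≡ = trans (cong (λ δ → lookup δ i) γ≡) (lookup∘updateAt i α)
    switchesᵢ : all (eqB (lookup β i)) (not (lookup α i) ∷ column i s) ≡ true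
    switchesᵢ = trans (sym (switchesOnce-switch (lookup α i) (lookup β i) (column i s)))
                  (subst (λ x → switchesOnce (lookup α i) (lookup β i) (lookup α i ∷ x ∷ column i s) ≡ true)
                         γᵢ≡ (all-allFin⁻ _ (proj₂ (proj₂ (proj₂ parts))) i))
    βᵢ≡ : lookup β i ≡ not (lookup α i)
    βᵢ≡ = eqB-sound (proj₁ (∧-≡true (eqB (lookup β i) (not (lookup α i))) switchesᵢ))

  switchesEachOnce-step : (α β : Assignment k) (i : Fin k) (s : List (Assignment k)) → differsAt α β i ≡ true →
                          switchesEachOnce α β (α ∷ flipAt α i ∷ s)
                          ≡ switchesEachOnce (flipAt α i) β (flipAt α i ∷ s)
  switchesEachOnce-step {k} α β i s d = cong and (map-cong pointwise (allFin k))
    where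
    γ = flipAt α i
    pointwise : ∀ j → switchesOnce (lookup α j) (lookup β j) (lookup α j ∷ lookup γ j ∷ column j s)
                    ≡ switchesOnce (lookup γ j) (lookup β j) (lookup γ j ∷ column j s)
    pointwise j with i ≟ j
    ... | yes refl = switch (column i s) (lookup∘updateAt i α) (differsAt⇒≡not α β i d)
      where
      switch : ∀ {a x c} vs → x ≡ not a → c ≡ not a →
               switchesOnce a c (a ∷ x ∷ vs) ≡ switchesOnce x c (x ∷ vs)
      switch {a} vs refl refl =
        trans (switchesOnce-switch a (not a) vs) (sym (switchesOnce-const (not a) (not a ∷ vs)))
    ... | no i≢j = stay (lookup β j) (column j s) (lookup∘updateAt′ j i (i≢j ∘ sym) α)
      where
      stay : ∀ {a x} c vs → x ≡ a → switchesOnce a c (a ∷ x ∷ vs) ≡ switchesOnce x c (x ∷ vs)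
      stay {a} c vs refl = switchesOnce-stay a c vs

  irredundant-step : (α β : Assignment k) (i : Fin k) (s : List (Assignment k)) → differsAt α β i ≡ true →
                     isIrredundant α β (α ∷ flipAt α i ∷ s)
                     ≡ isIrredundant (flipAt α i) β (flipAt α i ∷ s)
  irredundant-step α β i s d
    rewrite eqA-refl α | eqA-refl (flipAt α i) | hamming≡dist α (flipAt α i) | dist-flipAt-self α i
          | eqA-≢ α (flipAt α i) (flipAt-≢ α i) | switchesEachOnce-step α β i s d = refl

  -- Counting irredundant sequences

  ∑ₐ-point : (α : Assignment k) (f : Assignment k → ℕ) → (∀ γ → γ ≢ α → f γ ≡ 0) →
             ∑[ γ ∈ allAssignments k ] f γ ≡ f α
  ∑ₐ-point []      f vanish = +-identityʳ _
  ∑ₐ-point (x ∷ α) f vanish = begin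
    ∑[ γ ∈ allAssignments (suc _) ] f γ
      ≡⟨ ∑ₐ-∷ x f ⟩
    ∑[ γ ∈ allAssignments _ ] f (x ∷ γ) + ∑[ γ ∈ allAssignments _ ] f (not x ∷ γ)
      ≡⟨ cong₂ _+_ (∑ₐ-point α (f ∘ (x ∷_)) vanish-tail) (∑-ε (allAssignments _) (f ∘ (not x ∷_)) vanish-head) ⟩
    f (x ∷ α) + 0
      ≡⟨ +-identityʳ _ ⟩
    f (x ∷ α)
      ∎
    where
    open ≡-Reasoning
    vanish-tail : ∀ γ → γ ≢ α → f (x ∷ γ) ≡ 0
    vanish-tail γ γ≢α = vanish (x ∷ γ) (γ≢α ∘ ∷-injectiveʳ)
    vanish-head : ∀ γ → f (not x ∷ γ) ≡ 0
    vanish-head γ = vanish (not x ∷ γ) (not-¬ refl ∘ sym ∘ ∷-injectiveˡ)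

  ∑ₐ-flips : (α β : Assignment k) (f : Assignment k → ℕ) →
             (∀ γ → (∀ i → differsAt α β i ≡ true → γ ≢ flipAt α i) → f γ ≡ 0) →
             ∑[ γ ∈ allAssignments k ] f γ ≡ ∑[ i < k ] (𝟙 (differsAt α β i) * f (flipAt α i))
  ∑ₐ-flips []      []      f vanish = trans (+-identityʳ _) (vanish [] (λ ()))
  ∑ₐ-flips (x ∷ α) (y ∷ β) f vanish = begin
    ∑[ γ ∈ allAssignments (suc _) ] f γ
      ≡⟨ ∑ₐ-∷ x f ⟩
    ∑[ γ ∈ allAssignments _ ] f (x ∷ γ) + ∑[ γ ∈ allAssignments _ ] f (not x ∷ γ)
      ≡⟨ cong₂ _+_ (∑ₐ-flips α β (f ∘ (x ∷_)) vanish-tail) (∑ₐ-point α (f ∘ (not x ∷_)) vanish-head) ⟩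
    flipsOfTail + f (not x ∷ α)
      ≡⟨ +-comm flipsOfTail _ ⟩
    f (not x ∷ α) + flipsOfTail
      ≡⟨ cong (_+ flipsOfTail) head-flip ⟩
    𝟙 (not (eqB x y)) * f (not x ∷ α) + flipsOfTail
      ∎
    where
    open ≡-Reasoning
    flipsOfTail = ∑[ i < _ ] (𝟙 (differsAt α β i) * f (x ∷ flipAt α i))
    vanish-tail : ∀ γ → (∀ i → differsAt α β i ≡ true → γ ≢ flipAt α i) → f (x ∷ γ) ≡ 0
    vanish-tail γ not-flip = vanish (x ∷ γ) λ where
      zero    _ eq → not-¬ refl (∷-injectiveˡ eq)
      (suc i) d eq → not-flip i d (∷-injectiveʳ eq)
    vanish-head : ∀ γ → γ ≢ α → f (not x ∷ γ) ≡ 0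
    vanish-head γ γ≢α = vanish (not x ∷ γ) λ where
      zero    _ eq → γ≢α (∷-injectiveʳ eq)
      (suc i) _ eq → not-¬ refl (sym (∷-injectiveˡ eq))
    head-flip : f (not x ∷ α) ≡ 𝟙 (not (eqB x y)) * f (not x ∷ α)
    head-flip with not (eqB x y) in d
    ... | true  = sym (+-identityʳ _)
    ... | false = vanish (not x ∷ α) λ where
      zero    d′ _  → case trans (sym d) d′ of λ ()
      (suc i) _  eq → not-¬ refl (sym (∷-injectiveˡ eq))

  count-seqsOfLength-suc : (p : List (Assignment k) → Bool) (n : ℕ) →
                           count p (seqsOfLength k (suc n))
                           ≡ ∑[ γ ∈ allAssignments k ] count (p ∘ (γ ∷_)) (seqsOfLength k n)
  count-seqsOfLength-suc {k} p n =
    trans (count-concatMap p _ (allAssignments k))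
          (∑-cong (allAssignments k) (λ γ → count-map p (γ ∷_) (seqsOfLength k n)))

  irredundantWithin : (Assignment k → Bool) → Assignment k → Assignment k → List (Assignment k) → Bool
  irredundantWithin φ α β s = isIrredundant α β s ∧ all φ s

  #irredundant : (Assignment k → Bool) → Assignment k → Assignment k → ℕ → ℕ
  #irredundant {k} φ α β n = count (irredundantWithin φ α β) (seqsOfLength k n)

  #irredundant-suc : (φ : Assignment k → Bool) (α β : Assignment k) (n : ℕ) →
                     #irredundant φ α β (suc n) ≡ count (irredundantWithin φ α β ∘ (α ∷_)) (seqsOfLength k n)
  #irredundant-suc {k} φ α β n = trans (count-seqsOfLength-suc (irredundantWithin φ α β) n) (∑ₐ-point α _ vanish)
    where
    vanish : ∀ γ → γ ≢ α → count (irredundantWithin φ α β ∘ (γ ∷_)) (seqsOfLength k n) ≡ 0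
    vanish γ γ≢α = count-false _ (seqsOfLength k n) not-irredundant
      where
      not-irredundant : ∀ s → irredundantWithin φ α β (γ ∷ s) ≡ false
      not-irredundant s with isIrredundant α β (γ ∷ s) in irr
      ... | true  = ⊥-elim (γ≢α (irredundant-head α β γ s irr))
      ... | false = refl

  #irredundant-1 : (φ : Assignment k → Bool) (α β : Assignment k) → #irredundant φ α β 1 ≡ 𝟙 (eqA α β ∧ φ α)
  #irredundant-1 φ α β = begin
    #irredundant φ α β 1                                ≡⟨ #irredundant-suc φ α β 0 ⟩
    count (irredundantWithin φ α β ∘ (α ∷_)) ([] ∷ [])  ≡⟨ count-∷ (irredundantWithin φ α β ∘ (α ∷_)) [] [] ⟨
    𝟙 (isIrredundant α β (α ∷ []) ∧ (φ α ∧ true)) + 0   ≡⟨ +-identityʳ _ ⟩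
    𝟙 (isIrredundant α β (α ∷ []) ∧ (φ α ∧ true))
      ≡⟨ cong₂ (λ x y → 𝟙 (x ∧ y)) irredundant-[ α ] (∧-identityʳ (φ α)) ⟩
    𝟙 (eqA α β ∧ φ α)                                   ∎
    where open ≡-Reasoning

  #irredundant-2+ : (φ : Assignment k → Bool) (α β : Assignment k) (m : ℕ) →
                    #irredundant φ α β (2 + m)
                    ≡ ∑[ i < k ] (𝟙 (differsAt α β i) * (𝟙 (φ α) * #irredundant φ (flipAt α i) β (suc m)))
  #irredundant-2+ {k} φ α β m = begin
    #irredundant φ α β (2 + m)
      ≡⟨ #irredundant-suc φ α β (suc m) ⟩
    count Ψ (seqsOfLength k (suc m))
      ≡⟨ count-seqsOfLength-suc Ψ m ⟩
    ∑[ γ ∈ allAssignments k ] count (Ψ ∘ (γ ∷_)) (seqsOfLength k m)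
      ≡⟨ ∑ₐ-flips α β _ vanish ⟩
    ∑[ i < k ] (𝟙 (differsAt α β i) * count (Ψ ∘ (flipAt α i ∷_)) (seqsOfLength k m))
      ≡⟨ sum-cong-≗ (λ i → 𝟙*-cong (differsAt α β i) (step i)) ⟩
    ∑[ i < k ] (𝟙 (differsAt α β i) * (𝟙 (φ α) * #irredundant φ (flipAt α i) β (suc m)))
      ∎
    where
    open ≡-Reasoning
    Ψ = irredundantWithin φ α β ∘ (α ∷_)
    vanish : ∀ γ → (∀ i → differsAt α β i ≡ true → γ ≢ flipAt α i) → count (Ψ ∘ (γ ∷_)) (seqsOfLength k m) ≡ 0
    vanish γ not-flip = count-false _ (seqsOfLength k m) not-irredundant
      where
      not-irredundant : ∀ s → Ψ (γ ∷ s) ≡ false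
      not-irredundant s with isIrredundant α β (α ∷ γ ∷ s) in irr
      ... | true  = let (i , d , γ≡) = irredundant-second α β γ s irr in ⊥-elim (not-flip i d γ≡)
      ... | false = refl
    step : ∀ i → differsAt α β i ≡ true →
           count (Ψ ∘ (flipAt α i ∷_)) (seqsOfLength k m) ≡ 𝟙 (φ α) * #irredundant φ (flipAt α i) β (suc m)
    step i d = begin
      count (Ψ ∘ (γ ∷_)) (seqsOfLength k m)                         ≡⟨ count-cong (seqsOfLength k m) reorder ⟩
      count (λ s → φ α ∧ Ψ′ s) (seqsOfLength k m)                   ≡⟨ count-∧ (φ α) Ψ′ (seqsOfLength k m) ⟩
      𝟙 (φ α) * count Ψ′ (seqsOfLength k m)                         ≡⟨ cong (𝟙 (φ α) *_) (#irredundant-suc φ γ β m) ⟨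
      𝟙 (φ α) * #irredundant φ γ β (suc m)                          ∎
      where
      γ = flipAt α i
      Ψ′ = irredundantWithin φ γ β ∘ (γ ∷_)
      reorder : ∀ s → Ψ (γ ∷ s) ≡ φ α ∧ Ψ′ s
      reorder s rewrite irredundant-step α β i s d = ∧-swap (isIrredundant γ β (γ ∷ s)) (φ α) (all φ (γ ∷ s))
        where
        ∧-swap : ∀ x y z → x ∧ (y ∧ z) ≡ y ∧ (x ∧ z)
        ∧-swap true  y     z = refl
        ∧-swap false true  z = refl
        ∧-swap false false z = refl

  #irredundant-any : (α β : Assignment k) (n : ℕ) →
                     #irredundant (λ _ → true) α β n ≡ δ n (suc (dist α β)) (dist α β !)
  #irredundant-any α β zero          = refl
  #irredundant-any α β (suc zero)    rewrite #irredundant-1 (λ _ → true) α β | eqA≡0≡ᵇdist α β with dist α β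
  ... | zero  = refl
  ... | suc _ = refl
  #irredundant-any {k} α β (suc (suc m)) = begin
    #irredundant (λ _ → true) α β (2 + m)
      ≡⟨ #irredundant-2+ (λ _ → true) α β m ⟩
    ∑[ i < k ] (𝟙 (differsAt α β i) * (1 * #irredundant (λ _ → true) (flipAt α i) β (suc m)))
      ≡⟨ sum-cong-≗ (λ i → 𝟙*-cong (differsAt α β i) (shorter i (#irredundant-any (flipAt α i) β (suc m)))) ⟩
    ∑[ i < k ] (𝟙 (differsAt α β i) * δ (suc m) d (pred d !))
      ≡⟨ *-distribʳ-sum (δ (suc m) d (pred d !)) (𝟙 ∘ differsAt α β) ⟨
    d * δ (suc m) d (pred d !)
      ≡⟨ extend d ⟩
    δ (2 + m) (suc d) (d !)
      ∎
    where
    open ≡-Reasoning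
    d = dist α β
    shorter : ∀ i → let γ = flipAt α i in
              #irredundant (λ _ → true) γ β (suc m) ≡ δ (suc m) (suc (dist γ β)) (dist γ β !) →
              differsAt α β i ≡ true → 1 * #irredundant (λ _ → true) γ β (suc m) ≡ δ (suc m) d (pred d !)
    shorter i ih differs =
      trans (*-identityˡ _) (trans ih (cong (λ e → δ (suc m) e (pred e !)) (dist-flipAt α β i differs)))
    extend : ∀ d → d * δ (suc m) d (pred d !) ≡ δ (2 + m) (suc d) (d !)
    extend zero    = refl
    extend (suc e) = x∙yz≈y∙xz (suc e) (𝟙 (suc m ≡ᵇ suc e)) (e !)

  falsifyingTotal : Clause k → Assignment k → Assignment k → ℕ
  falsifyingTotal C α β = 𝟙 (sharedTrueLits C α β ≡ᵇ 0) * (trueLits C α ! * trueLits C β !)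

  #falsifying : Clause k → Assignment k → Assignment k → ℕ → ℕ
  #falsifying C α β n = δ n (suc (dist α β)) (falsifyingTotal C α β)

  #falsifying-flipAt : (C : Clause k) (α β : Assignment k) {a : ℕ} (m : ℕ) →
                       sharedTrueLits C α β ≡ 0 → trueLits C α ≡ suc a → ∀ i →
                       𝟙 (differsAt α β i) * #falsifying C (flipAt α i) β (suc m)
                       ≡ 𝟙 (litTrue C α i) * δ (suc m) (dist α β) (a ! * trueLits C β !)
  #falsifying-flipAt C α β {a} m s≡0 t≡ i with differsAt α β i in d
  ... | false = sym (cong (λ b → 𝟙 b * _) (litTrueᵢ≡false))
    where
    litTrueᵢ≡false : litTrue C α i ≡ false
    litTrueᵢ≡false = trans (sym (∧-idem (litTrue C α i)))
                       (trans (cong (λ x → litTrue C α i ∧ eqB x (lookup C i)) (¬differsAt⇒≡ α β i d))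
                         (sharedTrueLits≡0 C α β s≡0 i))
  ... | true with litTrue C α i in l
  ...   | true  rewrite sym (dist-flipAt α β i d) | sharedTrueLits-flipAt C α β i d | l | s≡0
                      | suc-injective (trans (trueLits-flipAt C α i l) t≡) =
    cong (λ x → 1 * δ (suc m) (suc (dist (flipAt α i) β)) x) (*-identityˡ (a ! * trueLits C β !))
  ...   | false rewrite sharedTrueLits-flipAt C α β i d | l | s≡0 =
    trans (*-identityˡ _) (*-zeroʳ (𝟙 (m ≡ᵇ dist (flipAt α i) β)))

  #falsifying-2+ : (C : Clause k) (α β : Assignment k) (m : ℕ) → trueLits C α ≢ 0 →
                   #falsifying C α β (2 + m)
                   ≡ ∑[ i < k ] (𝟙 (differsAt α β i) * #falsifying C (flipAt α i) β (suc m))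
  #falsifying-2+ {k} C α β m t≢0 with trueLits C α in t≡ | sharedTrueLits C α β in s≡
  ... | zero  | _     = ⊥-elim (t≢0 refl)
  ... | suc a | suc c =
    trans (*-zeroʳ (𝟙 (suc m ≡ᵇ dist α β))) (sym (trans (sum-cong-≗ vanish) (sum-replicate-zero k)))
    where
    vanish : ∀ i → 𝟙 (differsAt α β i) * #falsifying C (flipAt α i) β (suc m) ≡ 0
    vanish i with differsAt α β i in d
    ... | false = refl
    ... | true rewrite sharedTrueLits-flipAt C α β i d | s≡ =
      trans (*-identityˡ _) (*-zeroʳ (𝟙 (m ≡ᵇ dist (flipAt α i) β)))
  ... | suc a | zero  = sym (begin
    ∑[ i < k ] (𝟙 (differsAt α β i) * #falsifying C (flipAt α i) β (suc m))
      ≡⟨ sum-cong-≗ (#falsifying-flipAt C α β m s≡ t≡) ⟩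
    ∑[ i < k ] (𝟙 (litTrue C α i) * δ (suc m) d (a ! * T))
      ≡⟨ *-distribʳ-sum (δ (suc m) d (a ! * T)) (𝟙 ∘ litTrue C α) ⟨
    trueLits C α * δ (suc m) d (a ! * T)
      ≡⟨ cong (_* δ (suc m) d (a ! * T)) t≡ ⟩
    suc a * (𝟙 (suc m ≡ᵇ d) * (a ! * T))
      ≡⟨ x∙yz≈y∙xz (suc a) (𝟙 (suc m ≡ᵇ d)) (a ! * T) ⟩
    𝟙 (suc m ≡ᵇ d) * (suc a * (a ! * T))
      ≡⟨ cong (𝟙 (suc m ≡ᵇ d) *_) (trans (sym (*-assoc (suc a) (a !) T)) (sym (*-identityˡ _))) ⟩
    𝟙 (suc m ≡ᵇ d) * (1 * (suc a ! * T))
      ∎)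
    where
    open ≡-Reasoning
    d = dist α β
    T = trueLits C β !

  falsifyingTotal-unsatisfied : (C : Clause k) (α β : Assignment k) → trueLits C α ≡ 0 →
                                falsifyingTotal C α β ≡ dist α β !
  falsifyingTotal-unsatisfied C α β t≡0
    rewrite trueLits≡0⇒sharedTrueLits≡0 C α β t≡0 | t≡0 | trueLits≡0⇒dist≡trueLits C α β t≡0 =
    trans (*-identityˡ _) (*-identityˡ _)

  #irredundant-unsatisfied : (C : Clause k) (α β : Assignment k) (n : ℕ) → satisfies C α ≡ false →
                             #irredundant (satisfies C) α β (suc n) ≡ 0
  #irredundant-unsatisfied {k} C α β n unsat =
    trans (#irredundant-suc (satisfies C) α β n) (count-false _ (seqsOfLength k n) first-falsifies)
    where
    first-falsifies : ∀ s → irredundantWithin (satisfies C) α β (α ∷ s) ≡ false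
    first-falsifies s rewrite unsat = ∧-zeroʳ _

  #irredundant-satisfying-step :
    (C : Clause k) (α β : Assignment k) (m : ℕ) →
    (∀ γ → #irredundant (satisfies C) γ β (suc m) + #falsifying C γ β (suc m)
           ≡ #irredundant (λ _ → true) γ β (suc m)) →
    #irredundant (satisfies C) α β (2 + m) + #falsifying C α β (2 + m) ≡ #irredundant (λ _ → true) α β (2 + m)
  #irredundant-satisfying-step {k} C α β m ih with satisfies C α in sat
  ... | true = begin
    #irredundant (satisfies C) α β (2 + m) + #falsifying C α β (2 + m)
      ≡⟨ cong₂ _+_ (#irredundant-2+ (satisfies C) α β m) (#falsifying-2+ C α β m (satisfies⇒trueLits≢0 C α sat)) ⟩
    ∑[ i < k ] S i + ∑[ i < k ] (𝟙 (differsAt α β i) * F i)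
      ≡⟨ ∑-distrib-+ S (λ i → 𝟙 (differsAt α β i) * F i) ⟨
    ∑[ i < k ] (S i + 𝟙 (differsAt α β i) * F i)
      ≡⟨ sum-cong-≗ (λ i → split (differsAt α β i) (ih (flipAt α i))) ⟩
    ∑[ i < k ] (𝟙 (differsAt α β i) * (1 * #irredundant (λ _ → true) (flipAt α i) β (suc m)))
      ≡⟨ #irredundant-2+ (λ _ → true) α β m ⟨
    #irredundant (λ _ → true) α β (2 + m) ∎
    where
    open ≡-Reasoning
    S F : Fin k → ℕ
    S i = 𝟙 (differsAt α β i) * (𝟙 (satisfies C α) * #irredundant (satisfies C) (flipAt α i) β (suc m))
    F i = #falsifying C (flipAt α i) β (suc m)
    split : ∀ b {x y z} → x + y ≡ z → 𝟙 b * (𝟙 (satisfies C α) * x) + 𝟙 b * y ≡ 𝟙 b * (1 * z)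
    split b {x} {y} {z} x+y≡z rewrite sat = begin
      𝟙 b * (1 * x) + 𝟙 b * y  ≡⟨ *-distribˡ-+ (𝟙 b) (1 * x) y ⟨
      𝟙 b * (1 * x + y)        ≡⟨ cong (λ w → 𝟙 b * (w + y)) (*-identityˡ x) ⟩
      𝟙 b * (x + y)            ≡⟨ cong (𝟙 b *_) (trans x+y≡z (sym (*-identityˡ z))) ⟩
      𝟙 b * (1 * z)            ∎
  ... | false = begin
    #irredundant (satisfies C) α β (2 + m) + #falsifying C α β (2 + m)
      ≡⟨ cong (_+ #falsifying C α β (2 + m)) (#irredundant-unsatisfied C α β (suc m) sat) ⟩
    #falsifying C α β (2 + m)
      ≡⟨ cong (δ (2 + m) (suc (dist α β))) (falsifyingTotal-unsatisfied C α β (falsifies⇒trueLits≡0 C α sat)) ⟩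
    δ (2 + m) (suc (dist α β)) (dist α β !)
      ≡⟨ #irredundant-any α β (2 + m) ⟨
    #irredundant (λ _ → true) α β (2 + m) ∎
    where open ≡-Reasoning

  #irredundant-satisfying : (C : Clause k) (α β : Assignment k) (n : ℕ) →
                            #irredundant (satisfies C) α β n + #falsifying C α β n
                            ≡ #irredundant (λ _ → true) α β n
  #irredundant-satisfying C α β zero = refl
  #irredundant-satisfying C α β (suc zero)
    rewrite #irredundant-1 (satisfies C) α β | #irredundant-1 (λ _ → true) α β | eqA≡0≡ᵇdist α β
    with dist α β in d≡
  ... | suc _ = refl
  ... | zero rewrite dist≡0⇒≡ α β d≡ | sharedTrueLits-self C β | satisfies≡trueLits≢0 C β with trueLits C β
  ...   | zero  = refl
  ...   | suc _ = refl
  #irredundant-satisfying C α β (suc (suc m)) =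
    #irredundant-satisfying-step C α β m (λ γ → #irredundant-satisfying C γ β (suc m))

  count-irredundantSeqs : (φ : Assignment k → Bool) (α β : Assignment k) →
                          count (all φ) (irredundantSeqs α β) ≡ ∑[ n ∈ upTo (2 + k) ] #irredundant φ α β n
  count-irredundantSeqs {k} φ α β =
    trans (count-filterᵇ (isIrredundant α β) (all φ) (seqsUpTo k (suc k)))
          (count-concatMap (λ s → isIrredundant α β s ∧ all φ s) (seqsOfLength k) (upTo (2 + k)))

  ∑-#irredundant-any : (α β : Assignment k) → ∑[ n ∈ upTo (2 + k) ] #irredundant (λ _ → true) α β n ≡ dist α β !
  ∑-#irredundant-any {k} α β = trans (∑-cong (upTo (2 + k)) (#irredundant-any α β))
                                     (∑-upTo-δ (2 + k) (suc (dist α β)) (dist α β !) (s≤s (s≤s (dist≤ α β))))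

  length-irredundantSeqs : (α β : Assignment k) → length (irredundantSeqs α β) ≡ dist α β !
  length-irredundantSeqs {k} α β = begin
    length (irredundantSeqs α β)                           ≡⟨ count-all-true (irredundantSeqs α β) ⟨
    count (all (λ _ → true)) (irredundantSeqs α β)         ≡⟨ count-irredundantSeqs (λ _ → true) α β ⟩
    ∑[ n ∈ upTo (2 + k) ] #irredundant (λ _ → true) α β n  ≡⟨ ∑-#irredundant-any α β ⟩
    dist α β !                                             ∎
    where
    open ≡-Reasoning
    all-true : (s : List (Assignment k)) → all (λ _ → true) s ≡ true
    all-true []      = refl
    all-true (_ ∷ s) = all-true s
    count-all-true : (xs : List (List (Assignment k))) → count (all (λ _ → true)) xs ≡ length xs
    count-all-true []       = refl
    count-all-true (s ∷ xs) rewrite all-true s = cong suc (count-all-true xs)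

  count-satisfying-irredundantSeqs : (C : Clause k) (α β : Assignment k) →
                                     count (seqSatisfies C) (irredundantSeqs α β) + falsifyingTotal C α β
                                     ≡ dist α β !
  count-satisfying-irredundantSeqs {k} C α β = begin
    count (seqSatisfies C) (irredundantSeqs α β) + falsifyingTotal C α β
      ≡⟨ cong₂ _+_ (count-irredundantSeqs (satisfies C) α β)
                   (sym (∑-upTo-δ (2 + k) (suc (dist α β)) _ (s≤s (s≤s (dist≤ α β))))) ⟩
    ∑[ n ∈ upTo (2 + k) ] #irredundant (satisfies C) α β n + ∑[ n ∈ upTo (2 + k) ] #falsifying C α β n
      ≡⟨ ∑-distrib (upTo (2 + k)) (#irredundant (satisfies C) α β) (#falsifying C α β) ⟨
    ∑[ n ∈ upTo (2 + k) ] (#irredundant (satisfies C) α β n + #falsifying C α β n)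
      ≡⟨ ∑-cong (upTo (2 + k)) (#irredundant-satisfying C α β) ⟩
    ∑[ n ∈ upTo (2 + k) ] #irredundant (λ _ → true) α β n
      ≡⟨ ∑-#irredundant-any α β ⟩
    dist α β ! ∎
    where open ≡-Reasoning

  -- Reconfiguration through a midpoint

  falsifyingTotal-bound : (C : Clause k) (α β : Assignment k) → trueLits C α ≢ 0 →
                          falsifyingTotal C α β * suc (trueLits C β)
                          ≤ 𝟙 (sharedTrueLits C α β ≡ᵇ 0) * dist α β !
  falsifyingTotal-bound C α β t≢0 with sharedTrueLits C α β in s≡ | trueLits C α in t≡
  ... | suc _ | _     = z≤n
  ... | zero  | zero  = ⊥-elim (t≢0 refl)
  ... | zero  | suc a = begin
    1 * (suc a ! * T !) * suc T  ≡⟨ cong (_* suc T) (*-identityˡ (suc a ! * T !)) ⟩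
    suc a ! * T ! * suc T        ≡⟨ *-assoc (suc a !) (T !) (suc T) ⟩
    suc a ! * (T ! * suc T)      ≡⟨ cong (suc a ! *_) (*-comm (T !) (suc T)) ⟩
    suc a ! * suc T !            ≤⟨ suc!*suc!≤ a T ⟩
    (suc a + T) !                ≡⟨ cong _! dist≡ ⟨
    dist α β !                   ≡⟨ *-identityˡ (dist α β !) ⟨
    1 * dist α β !               ∎
    where
    open ≤-Reasoning
    T = trueLits C β
    dist≡ : dist α β ≡ suc a + T
    dist≡ = begin-equality
      dist α β                     ≡⟨ +-identityʳ _ ⟨
      dist α β + 0                 ≡⟨ cong (λ s → dist α β + (s + s)) s≡ ⟨
      dist α β + (S + S)           ≡⟨ dist+2*shared C α β ⟩
      trueLits C α + T             ≡⟨ cong (_+ T) t≡ ⟩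
      suc a + T                    ∎
      where S = sharedTrueLits C α β

  falsifyingTotal-sym : (C : Clause k) (α β : Assignment k) →
                        falsifyingTotal C α β ≡ falsifyingTotal C β α
  falsifyingTotal-sym C α β =
    cong₂ (λ s t → 𝟙 (s ≡ᵇ 0) * t) (sharedTrueLits-sym C α β) (*-comm (trueLits C α !) (trueLits C β !))

  #paths : Assignment k → Assignment k → Assignment k → ℕ
  #paths αs r αe = length (irredundantSeqs3 αs r αe)

  #satisfyingPaths : Clause k → Assignment k → Assignment k → Assignment k → ℕ
  #satisfyingPaths C αs r αe = count (λ (s₁ , s₂) → seqSatisfies C (s₁ ++ s₂)) (irredundantSeqs3 αs r αe)

  #paths≥1 : (αs r αe : Assignment k) → 1 ≤ #paths αs r αe
  #paths≥1 αs r αe rewrite length-cartesianProduct (irredundantSeqs αs r) (irredundantSeqs r αe)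
                         | length-irredundantSeqs αs r | length-irredundantSeqs r αe =
    *-mono-≤ (1≤n! (dist αs r)) (1≤n! (dist r αe))

  #satisfyingPaths-bound : (C : Clause k) (αs r αe : Assignment k) → trueLits C αs ≢ 0 → trueLits C αe ≢ 0 →
                           let T = #paths αs r αe ; s = suc (trueLits C r) in
                           T * s ≤ #satisfyingPaths C αs r αe * s + 𝟙 (sharedTrueLits C αs r ≡ᵇ 0) * T
                                                                  + 𝟙 (sharedTrueLits C r αe ≡ᵇ 0) * T
  #satisfyingPaths-bound C αs r αe t₁≢0 t₂≢0 =
    subst₂ (λ T G → T * s ≤ G * s + e₁ * T + e₂ * T) (sym paths≡) (sym satisfying≡)
           (union-bound g₁ b₁ g₂ b₂ s e₁ e₂ bound₁ bound₂)
    where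
    open ≤-Reasoning
    seqs₁ = irredundantSeqs αs r
    seqs₂ = irredundantSeqs r αe
    g₁ = count (seqSatisfies C) seqs₁
    g₂ = count (seqSatisfies C) seqs₂
    b₁ = falsifyingTotal C αs r
    b₂ = falsifyingTotal C r αe
    e₁ = 𝟙 (sharedTrueLits C αs r ≡ᵇ 0)
    e₂ = 𝟙 (sharedTrueLits C r αe ≡ᵇ 0)
    s = suc (trueLits C r)
    paths≡ : #paths αs r αe ≡ (g₁ + b₁) * (g₂ + b₂)
    paths≡ = trans (length-cartesianProduct seqs₁ seqs₂)
               (cong₂ _*_ (trans (length-irredundantSeqs αs r) (sym (count-satisfying-irredundantSeqs C αs r)))
                          (trans (length-irredundantSeqs r αe) (sym (count-satisfying-irredundantSeqs C r αe))))
    satisfying≡ : #satisfyingPaths C αs r αe ≡ g₁ * g₂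
    satisfying≡ = trans (count-cong (cartesianProduct seqs₁ seqs₂) (λ (s₁ , s₂) → all-++ (satisfies C) s₁ s₂))
                        (count-cartesianProduct (seqSatisfies C) (seqSatisfies C) seqs₁ seqs₂)
    bound₁ : b₁ * s ≤ e₁ * (g₁ + b₁)
    bound₁ = begin
      b₁ * s               ≤⟨ falsifyingTotal-bound C αs r t₁≢0 ⟩
      e₁ * dist αs r !     ≡⟨ cong (e₁ *_) (count-satisfying-irredundantSeqs C αs r) ⟨
      e₁ * (g₁ + b₁)       ∎
    bound₂ : b₂ * s ≤ e₂ * (g₂ + b₂)
    bound₂ = begin
      b₂ * s                                          ≡⟨ cong (_* s) (falsifyingTotal-sym C r αe) ⟩
      falsifyingTotal C αe r * s                      ≤⟨ falsifyingTotal-bound C αe r t₂≢0 ⟩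
      𝟙 (sharedTrueLits C αe r ≡ᵇ 0) * dist αe r !
        ≡⟨ cong₂ (λ c d → 𝟙 (c ≡ᵇ 0) * d !) (sharedTrueLits-sym C αe r) (dist-sym αe r) ⟩
      e₂ * dist r αe !                                ≡⟨ cong (e₂ *_) (count-satisfying-irredundantSeqs C r αe) ⟨
      e₂ * (g₂ + b₂)                                  ∎

module Probability where

  open import Data.Integer as ℤ using ()
  import Data.Integer.Properties as ℤ
  open import Data.Nat as ℕ using (_≡ᵇ_; _^_)
  import Data.Nat.Properties as ℕ
  open import Data.Rational using (ℚ; 0ℚ; 1ℚ; _+_; _*_; _-_; -_; _≤_; _/_; toℚᵘ; Positive; NonNegative)
  open import Data.Rational.Properties
  open import Data.Rational.Solver using (module +-*-Solver)
  import Data.Rational.Unnormalised as ℚᵘ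
  import Data.Rational.Unnormalised.Properties as ℚᵘ
  open ListSum +-0-isCommutativeMonoid
  open Combinatorics

  fromℕ : ℕ → ℚ
  fromℕ n = ℤ.+ n / 1

  private
    toℚᵘ-fromℕ : ∀ n → toℚᵘ (fromℕ n) ℚᵘ.≃ ℚᵘ.mkℚᵘ (ℤ.+ n) 0
    toℚᵘ-fromℕ n = toℚᵘ-fromℚᵘ (ℚᵘ.mkℚᵘ (ℤ.+ n) 0)

    toℚᵘ-ratio : ∀ n d → toℚᵘ (ratio n (suc d)) ℚᵘ.≃ ℚᵘ.mkℚᵘ (ℤ.+ n) d
    toℚᵘ-ratio n d = toℚᵘ-fromℚᵘ (ℚᵘ.mkℚᵘ (ℤ.+ n) d)

  fromℕ-+ : ∀ m n → fromℕ (m ℕ.+ n) ≡ fromℕ m + fromℕ n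
  fromℕ-+ m n = toℚᵘ-injective (begin
    toℚᵘ (fromℕ (m ℕ.+ n))                      ≈⟨ toℚᵘ-fromℕ (m ℕ.+ n) ⟩
    ℚᵘ.mkℚᵘ (ℤ.+ (m ℕ.+ n)) 0                   ≈⟨ ℚᵘ.*≡* cross-multiplied ⟩
    ℚᵘ.mkℚᵘ (ℤ.+ m) 0 ℚᵘ.+ ℚᵘ.mkℚᵘ (ℤ.+ n) 0    ≈⟨ ℚᵘ.+-cong (toℚᵘ-fromℕ m) (toℚᵘ-fromℕ n) ⟨
    toℚᵘ (fromℕ m) ℚᵘ.+ toℚᵘ (fromℕ n)          ≈⟨ toℚᵘ-homo-+ (fromℕ m) (fromℕ n) ⟨
    toℚᵘ (fromℕ m + fromℕ n)                    ∎)
    where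
    open ℚᵘ.≃-Reasoning
    cross-multiplied = trans (ℤ.*-identityʳ _)
                         (sym (trans (ℤ.*-identityʳ _) (cong₂ ℤ._+_ (ℤ.*-identityʳ (ℤ.+ m)) (ℤ.*-identityʳ (ℤ.+ n)))))

  fromℕ-* : ∀ m n → fromℕ (m ℕ.* n) ≡ fromℕ m * fromℕ n
  fromℕ-* m n = toℚᵘ-injective (begin
    toℚᵘ (fromℕ (m ℕ.* n))                      ≈⟨ toℚᵘ-fromℕ (m ℕ.* n) ⟩
    ℚᵘ.mkℚᵘ (ℤ.+ (m ℕ.* n)) 0                   ≈⟨ ℚᵘ.*≡* cross-multiplied ⟩
    ℚᵘ.mkℚᵘ (ℤ.+ m) 0 ℚᵘ.* ℚᵘ.mkℚᵘ (ℤ.+ n) 0    ≈⟨ ℚᵘ.*-cong (toℚᵘ-fromℕ m) (toℚᵘ-fromℕ n) ⟨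
    toℚᵘ (fromℕ m) ℚᵘ.* toℚᵘ (fromℕ n)          ≈⟨ toℚᵘ-homo-* (fromℕ m) (fromℕ n) ⟨
    toℚᵘ (fromℕ m * fromℕ n)                    ∎)
    where
    open ℚᵘ.≃-Reasoning
    cross-multiplied = trans (ℤ.*-identityʳ _) (sym (trans (ℤ.*-identityʳ (ℤ.+ m ℤ.* ℤ.+ n)) (sym (ℤ.pos-* m n))))

  fromℕ-suc : ∀ n → fromℕ (suc n) ≡ 1ℚ + fromℕ n
  fromℕ-suc n = fromℕ-+ 1 n

  fromℕ-2^suc : ∀ n → fromℕ (2 ^ suc n) ≡ fromℕ (2 ^ n) + fromℕ (2 ^ n)
  fromℕ-2^suc n =
    trans (fromℕ-+ (2 ^ n) (2 ^ n ℕ.+ 0)) (cong (λ z → fromℕ (2 ^ n) + fromℕ z) (ℕ.+-identityʳ (2 ^ n)))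

  ratio*fromℕ : ∀ n d → ratio n (suc d) * fromℕ (suc d) ≡ fromℕ n
  ratio*fromℕ n d = toℚᵘ-injective (begin
    toℚᵘ (ratio n (suc d) * fromℕ (suc d))            ≈⟨ toℚᵘ-homo-* (ratio n (suc d)) (fromℕ (suc d)) ⟩
    toℚᵘ (ratio n (suc d)) ℚᵘ.* toℚᵘ (fromℕ (suc d))  ≈⟨ ℚᵘ.*-cong (toℚᵘ-ratio n d) (toℚᵘ-fromℕ (suc d)) ⟩
    ℚᵘ.mkℚᵘ (ℤ.+ n) d ℚᵘ.* ℚᵘ.mkℚᵘ (ℤ.+ suc d) 0      ≈⟨ ℚᵘ.*≡* cross-multiplied ⟩
    ℚᵘ.mkℚᵘ (ℤ.+ n) 0                                 ≈⟨ toℚᵘ-fromℕ n ⟨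
    toℚᵘ (fromℕ n)                                    ∎)
    where
    open ℚᵘ.≃-Reasoning
    cross-multiplied = trans (ℤ.*-identityʳ _) (cong (λ x → ℤ.+ n ℤ.* ℤ.+ x) (sym (ℕ.*-identityʳ (suc d))))

  ratio1*fromℕ : ∀ N → 1 ℕ.≤ N → ratio 1 N * fromℕ N ≡ 1ℚ
  ratio1*fromℕ (suc d) _ = ratio*fromℕ 1 d

  fromℕ-mono-≤ : ∀ {m n} → m ℕ.≤ n → fromℕ m ≤ fromℕ n
  fromℕ-mono-≤ {m} {n} m≤n = toℚᵘ-cancel-≤ (begin
    toℚᵘ (fromℕ m)     ≃⟨ toℚᵘ-fromℕ m ⟩
    ℚᵘ.mkℚᵘ (ℤ.+ m) 0  ≤⟨ ℚᵘ.*≤* (ℤ.*-monoʳ-≤-nonNeg (ℤ.+ 1) (ℤ.+≤+ m≤n)) ⟩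
    ℚᵘ.mkℚᵘ (ℤ.+ n) 0  ≃⟨ toℚᵘ-fromℕ n ⟨
    toℚᵘ (fromℕ n)     ∎)
    where open ℚᵘ.≤-Reasoning

  fromℕ-pos : ∀ n → Positive (fromℕ (suc n))
  fromℕ-pos n = normalize-pos (suc n) 1

  ratio-nonNeg : ∀ n d → NonNegative (ratio n d)
  ratio-nonNeg n zero    = _
  ratio-nonNeg n (suc d) = normalize-nonNeg n (suc d)

  ratio-0 : ∀ d → ratio 0 d ≡ 0ℚ
  ratio-0 zero    = refl
  ratio-0 (suc d) = 0/n≡0 (suc d)

  ratio1*≤ : ∀ {x} n N → 1 ℕ.≤ N → fromℕ (suc n) * x ≤ fromℕ N → ratio 1 N * x ≤ ratio 1 (suc n)
  ratio1*≤ {x} n (suc d) _ Kx≤N = *-cancelʳ-≤-pos K {{fromℕ-pos n}} (begin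
    (R * x) * K           ≡⟨ solve 3 (λ R x K → (R :* x) :* K := R :* (K :* x)) refl R x K ⟩
    R * (K * x)           ≤⟨ *-monoˡ-≤-nonNeg R {{ratio-nonNeg 1 (suc d)}} Kx≤N ⟩
    R * fromℕ (suc d)     ≡⟨ ratio*fromℕ 1 d ⟩
    fromℕ 1               ≡⟨ ratio*fromℕ 1 n ⟨
    ratio 1 (suc n) * K   ∎)
    where
    open ≤-Reasoning
    open +-*-Solver
    K = fromℕ (suc n)
    R = ratio 1 (suc d)

  ratio1-antitone : ∀ {m n} → m ℕ.≤ n → ratio 1 (suc n) ≤ ratio 1 (suc m)
  ratio1-antitone {m} {n} m≤n = begin
    ratio 1 (suc n)         ≡⟨ *-identityʳ _ ⟨
    ratio 1 (suc n) * 1ℚ    ≤⟨ ratio1*≤ m (suc n) (ℕ.s≤s ℕ.z≤n) (≤-trans (≤-reflexive (*-identityʳ _)) suc-m≤suc-n) ⟩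
    ratio 1 (suc m)         ∎
    where
    open ≤-Reasoning
    suc-m≤suc-n = fromℕ-mono-≤ (ℕ.s≤s m≤n)

  1-a-b-antitone : ∀ {a a′ b b′} → a ≤ a′ → b ≤ b′ → (1ℚ - a′) - b′ ≤ (1ℚ - a) - b
  1-a-b-antitone a≤a′ b≤b′ = +-mono-≤ (+-monoʳ-≤ 1ℚ (neg-antimono-≤ a≤a′)) (neg-antimono-≤ b≤b′)

  ∑-mono : ∀ {A : Set} (xs : List A) {f g : A → ℚ} → (∀ x → f x ≤ g x) →
           ∑[ x ∈ xs ] f x ≤ ∑[ x ∈ xs ] g x
  ∑-mono []       f≤g = ≤-refl
  ∑-mono (x ∷ xs) f≤g = +-mono-≤ (f≤g x) (∑-mono xs f≤g)

  ∑-1-minus : ∀ {A : Set} (xs : List A) (f g : A → ℚ) →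
              ∑[ x ∈ xs ] ((1ℚ - f x) - g x) ≡ (fromℕ (length xs) - ∑[ x ∈ xs ] f x) - ∑[ x ∈ xs ] g x
  ∑-1-minus []       f g = refl
  ∑-1-minus (x ∷ xs) f g = begin
    ((1ℚ - f x) - g x) + ∑[ y ∈ xs ] ((1ℚ - f y) - g y)  ≡⟨ cong (((1ℚ - f x) - g x) +_) (∑-1-minus xs f g) ⟩
    ((1ℚ - f x) - g x) + ((fromℕ (length xs) - F) - G)   ≡⟨ regroup (f x) (g x) (fromℕ (length xs)) F G ⟩
    ((1ℚ + fromℕ (length xs)) - (f x + F)) - (g x + G)   ≡⟨ cong (λ n → (n - (f x + F)) - (g x + G)) n+1≡ ⟨
    (fromℕ (suc (length xs)) - (f x + F)) - (g x + G)    ∎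
    where
    open ≡-Reasoning
    open +-*-Solver
    F = ∑[ y ∈ xs ] f y
    G = ∑[ y ∈ xs ] g y
    n+1≡ = fromℕ-suc (length xs)
    regroup : ∀ a b n A B → ((1ℚ - a) - b) + ((n - A) - B) ≡ ((1ℚ + n) - (a + A)) - (b + B)
    regroup = solve 5 (λ a b n A B → ((con 1ℚ :- a) :- b) :+ ((n :- A) :- B)
                                     := ((con 1ℚ :+ n) :- (a :+ A)) :- (b :+ B)) refl

  length-allAssignments : ∀ k → length (allAssignments k) ≡ 2 ^ k
  length-allAssignments zero    = refl
  length-allAssignments (suc k) = trans (length-doubled (allAssignments k))
                                        (cong (λ n → n ℕ.+ (n ℕ.+ 0)) (length-allAssignments k))
    where
    length-doubled : (xs : List (Assignment k)) →
                     length (concatMap (λ v → (false ∷ v) ∷ (true ∷ v) ∷ []) xs) ≡ length xs ℕ.+ (length xs ℕ.+ 0)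
    length-doubled []       = refl
    length-doubled (x ∷ xs) = cong suc (trans (cong suc (length-doubled xs)) (sym (ℕ.+-suc (length xs) _)))

  ratio-lower-bound : ∀ T g s e₁ e₂ → 1 ℕ.≤ T →
                      T ℕ.* suc s ℕ.≤ g ℕ.* suc s ℕ.+ e₁ ℕ.* T ℕ.+ e₂ ℕ.* T →
                      (1ℚ - ratio e₁ (suc s)) - ratio e₂ (suc s) ≤ ratio g T
  ratio-lower-bound (suc t) g s e₁ e₂ _ bound =
    *-cancelʳ-≤-pos (fromℕ (suc s ℕ.* suc t)) {{fromℕ-pos (t ℕ.+ s ℕ.* suc t)}} (begin
      ((1ℚ - w₁) - w₂) * fromℕ (suc s ℕ.* suc t)  ≡⟨ cong (((1ℚ - w₁) - w₂) *_) (fromℕ-* (suc s) (suc t)) ⟩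
      ((1ℚ - w₁) - w₂) * (S * T)                  ≡⟨ clear-denominators w₁ w₂ S T ⟩
      (T * S - (w₁ * S) * T) - (w₂ * S) * T       ≡⟨ cong₂ (λ x y → (T * S - x * T) - y * T) (ratio*fromℕ e₁ s)
                                                                                              (ratio*fromℕ e₂ s) ⟩
      (T * S - fromℕ e₁ * T) - fromℕ e₂ * T       ≤⟨ move-to-left (T * S) (fromℕ g * S) _ _ boundℚ ⟩
      fromℕ g * S                                 ≡⟨ cong (_* S) (ratio*fromℕ g t) ⟨
      (ratio g (suc t) * T) * S                   ≡⟨ reassociate (ratio g (suc t)) S T ⟩
      ratio g (suc t) * (S * T)                   ≡⟨ cong (ratio g (suc t) *_) (fromℕ-* (suc s) (suc t)) ⟨
      ratio g (suc t) * fromℕ (suc s ℕ.* suc t)   ∎)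
    where
    open ≤-Reasoning
    open +-*-Solver
    S = fromℕ (suc s)
    T = fromℕ (suc t)
    w₁ = ratio e₁ (suc s)
    w₂ = ratio e₂ (suc s)
    clear-denominators : ∀ w₁ w₂ S T → ((1ℚ - w₁) - w₂) * (S * T) ≡ (T * S - (w₁ * S) * T) - (w₂ * S) * T
    clear-denominators = solve 4 (λ w₁ w₂ S T → ((con 1ℚ :- w₁) :- w₂) :* (S :* T)
                                                := (T :* S :- (w₁ :* S) :* T) :- (w₂ :* S) :* T) refl
    reassociate : ∀ r S T → (r * T) * S ≡ r * (S * T)
    reassociate = solve 3 (λ r S T → (r :* T) :* S := r :* (S :* T)) refl
    move-to-left : ∀ a b c d → a ≤ (b + c) + d → (a - c) - d ≤ b
    move-to-left a b c d a≤ = begin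
      (a - c) - d              ≡⟨ solve 3 (λ a c d → (a :- c) :- d := a :- (c :+ d)) refl a c d ⟩
      a - (c + d)              ≤⟨ +-monoˡ-≤ (- (c + d)) a≤ ⟩
      ((b + c) + d) - (c + d)  ≡⟨ solve 3 (λ b c d → ((b :+ c) :+ d) :- (c :+ d) := b) refl b c d ⟩
      b                        ∎
    boundℚ : T * S ≤ (fromℕ g * S + fromℕ e₁ * T) + fromℕ e₂ * T
    boundℚ = begin
      T * S                                                  ≡⟨ fromℕ-* (suc t) (suc s) ⟨
      fromℕ (suc t ℕ.* suc s)                                ≤⟨ fromℕ-mono-≤ bound ⟩
      fromℕ (g ℕ.* suc s ℕ.+ e₁ ℕ.* suc t ℕ.+ e₂ ℕ.* suc t)  ≡⟨ fromℕ-polynomial ⟩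
      (fromℕ g * S + fromℕ e₁ * T) + fromℕ e₂ * T            ∎
      where
      fromℕ-polynomial =
        trans (fromℕ-+ (g ℕ.* suc s ℕ.+ e₁ ℕ.* suc t) (e₂ ℕ.* suc t))
              (cong₂ _+_ (trans (fromℕ-+ (g ℕ.* suc s) (e₁ ℕ.* suc t))
                                (cong₂ _+_ (fromℕ-* g (suc s)) (fromℕ-* e₁ (suc t))))
                         (fromℕ-* e₂ (suc t)))

  -- harmonicBinomial m c = ∑ⱼ (m choose j) / (c + j + 1) = ∫₀¹ xᶜ (1 + x)ᵐ dx
  harmonicBinomial : ℕ → ℕ → ℚ
  harmonicBinomial zero    c = ratio 1 (suc c)
  harmonicBinomial (suc m) c = harmonicBinomial m c + harmonicBinomial m (suc c)

  harmonicBinomial-nonNeg : ∀ m c → 0ℚ ≤ harmonicBinomial m c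
  harmonicBinomial-nonNeg zero    c = nonNegative⁻¹ _ {{ratio-nonNeg 1 (suc c)}}
  harmonicBinomial-nonNeg (suc m) c =
    +-mono-≤ (harmonicBinomial-nonNeg m c) (harmonicBinomial-nonNeg m (suc c))

  harmonicBinomial≤-suc : ∀ m c → harmonicBinomial m c ≤ harmonicBinomial (suc m) c
  harmonicBinomial≤-suc m c = begin
    harmonicBinomial m c                               ≡⟨ +-identityʳ _ ⟨
    harmonicBinomial m c + 0ℚ
      ≤⟨ +-monoʳ-≤ (harmonicBinomial m c) (harmonicBinomial-nonNeg m (suc c)) ⟩
    harmonicBinomial m c + harmonicBinomial m (suc c)  ∎
    where open ≤-Reasoning

  -- Integration by parts of ∫₀¹ xᶜ (1 + x)ᵐ⁺¹ dx.
  harmonicBinomial-by-parts : ∀ m c → fromℕ (suc c) * harmonicBinomial (suc m) c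
                                      + fromℕ (suc m) * harmonicBinomial m (suc c)
                                      ≡ fromℕ (2 ^ suc m)
  harmonicBinomial-by-parts zero c = begin
    X * (r₁ + r₂) + 1ℚ * r₂               ≡⟨ rearrange X r₁ r₂ ⟩
    r₁ * X + r₂ * (1ℚ + X)                ≡⟨ cong (λ y → r₁ * X + r₂ * y) (fromℕ-suc (suc c)) ⟨
    r₁ * X + r₂ * fromℕ (suc (suc c))     ≡⟨ cong₂ _+_ (ratio*fromℕ 1 c) (ratio*fromℕ 1 (suc c)) ⟩
    fromℕ 1 + fromℕ 1                     ≡⟨ fromℕ-+ 1 1 ⟨
    fromℕ 2                               ∎
    where
    open ≡-Reasoning
    open +-*-Solver
    X = fromℕ (suc c)
    r₁ = ratio 1 (suc c)
    r₂ = ratio 1 (suc (suc c))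
    rearrange : ∀ X r₁ r₂ → X * (r₁ + r₂) + 1ℚ * r₂ ≡ r₁ * X + r₂ * (1ℚ + X)
    rearrange = solve 3 (λ X r₁ r₂ → X :* (r₁ :+ r₂) :+ con 1ℚ :* r₂ := r₁ :* X :+ r₂ :* (con 1ℚ :+ X)) refl
  harmonicBinomial-by-parts (suc m) c = begin
    X * (a + (p + q)) + fromℕ (suc (suc m)) * (p + q)
      ≡⟨ cong (λ y → X * (a + (p + q)) + y * (p + q)) (fromℕ-suc (suc m)) ⟩
    X * (a + (p + q)) + (1ℚ + Y) * (p + q)
      ≡⟨ rearrange X Y a p q ⟩
    (X * a + Y * p) + ((1ℚ + X) * (p + q) + Y * q)
      ≡⟨ cong (λ y → (X * a + Y * p) + (y * (p + q) + Y * q)) (fromℕ-suc (suc c)) ⟨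
    (X * a + Y * p) + (fromℕ (suc (suc c)) * (p + q) + Y * q)
      ≡⟨ cong₂ _+_ (harmonicBinomial-by-parts m c) (harmonicBinomial-by-parts m (suc c)) ⟩
    fromℕ (2 ^ suc m) + fromℕ (2 ^ suc m)
      ≡⟨ fromℕ-2^suc (suc m) ⟨
    fromℕ (2 ^ suc (suc m))
      ∎
    where
    open ≡-Reasoning
    open +-*-Solver
    X = fromℕ (suc c)
    Y = fromℕ (suc m)
    a = harmonicBinomial (suc m) c
    p = harmonicBinomial m (suc c)
    q = harmonicBinomial m (suc (suc c))
    rearrange : ∀ X Y a p q →
                X * (a + (p + q)) + (1ℚ + Y) * (p + q) ≡ (X * a + Y * p) + ((1ℚ + X) * (p + q) + Y * q)
    rearrange = solve 5 (λ X Y a p q → X :* (a :+ (p :+ q)) :+ (con 1ℚ :+ Y) :* (p :+ q)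
                                       := (X :* a :+ Y :* p) :+ ((con 1ℚ :+ X) :* (p :+ q) :+ Y :* q)) refl

  harmonicBinomial-0 : ∀ m → fromℕ (suc m) * harmonicBinomial m 0 ≡ fromℕ (2 ^ suc m) - 1ℚ
  harmonicBinomial-0 zero    = refl
  harmonicBinomial-0 (suc m) = begin
    fromℕ (suc (suc m)) * (h₀ + h₁)        ≡⟨ cong (_* (h₀ + h₁)) (fromℕ-suc (suc m)) ⟩
    (1ℚ + Y) * (h₀ + h₁)                   ≡⟨ rearrange Y h₀ h₁ ⟩
    (1ℚ * (h₀ + h₁) + Y * h₁) + Y * h₀     ≡⟨ cong₂ _+_ (harmonicBinomial-by-parts m 0) (harmonicBinomial-0 m) ⟩
    P + (P - 1ℚ)                           ≡⟨ solve 1 (λ P → P :+ (P :- con 1ℚ) := (P :+ P) :- con 1ℚ) refl P ⟩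
    (P + P) - 1ℚ                           ≡⟨ cong (_- 1ℚ) (fromℕ-2^suc (suc m)) ⟨
    fromℕ (2 ^ suc (suc m)) - 1ℚ           ∎
    where
    open ≡-Reasoning
    open +-*-Solver
    Y = fromℕ (suc m)
    P = fromℕ (2 ^ suc m)
    h₀ = harmonicBinomial m 0
    h₁ = harmonicBinomial m 1
    rearrange : ∀ Y h₀ h₁ → (1ℚ + Y) * (h₀ + h₁) ≡ (1ℚ * (h₀ + h₁) + Y * h₁) + Y * h₀
    rearrange = solve 3 (λ Y h₀ h₁ → (con 1ℚ :+ Y) :* (h₀ :+ h₁) := (con 1ℚ :* (h₀ :+ h₁) :+ Y :* h₁) :+ Y :* h₀)
                        refl

  nonSharingWeight : ∀ {k} → Clause k → Assignment k → ℕ → Assignment k → ℚ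
  nonSharingWeight C α c r = ratio (𝟙 (sharedTrueLits C α r ≡ᵇ 0)) (suc c ℕ.+ trueLits C r)

  totalWeight : ∀ {k} → Clause k → Assignment k → ℕ → ℚ
  totalWeight {k} C α c = ∑[ r ∈ allAssignments k ] nonSharingWeight C α c r

  totalWeight-[] : ∀ c → totalWeight [] [] c ≡ harmonicBinomial 0 c
  totalWeight-[] c = trans (+-identityʳ _) (cong (λ n → ratio 1 (suc n)) (ℕ.+-identityʳ c))

  nonSharingWeight-shift : ∀ {k} (C : Clause k) (α : Assignment k) c r →
                           ratio (𝟙 (sharedTrueLits C α r ≡ᵇ 0)) (suc c ℕ.+ suc (trueLits C r))
                           ≡ nonSharingWeight C α (suc c) r
  nonSharingWeight-shift C α c r =
    cong (λ n → ratio (𝟙 (sharedTrueLits C α r ≡ᵇ 0)) (suc n)) (ℕ.+-suc c (trueLits C r))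

  totalWeight-litTrue : ∀ {k} c₀ (C : Clause k) x (α : Assignment k) c → eqB x c₀ ≡ true →
                        totalWeight (c₀ ∷ C) (x ∷ α) c ≡ totalWeight C α c
  totalWeight-litTrue {k} true  C true  α c _ = begin
    totalWeight (true ∷ C) (true ∷ α) c
      ≡⟨ ∑ₐ-∷ true (nonSharingWeight (true ∷ C) (true ∷ α) c) ⟩
    (∑[ r ∈ allAssignments k ] nonSharingWeight (true ∷ C) (true ∷ α) c (true ∷ r)) + totalWeight C α c
      ≡⟨ cong (_+ totalWeight C α c) (∑-ε (allAssignments k) _ (λ r → ratio-0 (suc c ℕ.+ suc (trueLits C r)))) ⟩
    0ℚ + totalWeight C α c
      ≡⟨ +-identityˡ _ ⟩
    totalWeight C α c
      ∎
    where open ≡-Reasoning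
  totalWeight-litTrue {k} false C false α c _ = begin
    totalWeight (false ∷ C) (false ∷ α) c
      ≡⟨ ∑ₐ-∷ false (nonSharingWeight (false ∷ C) (false ∷ α) c) ⟩
    (∑[ r ∈ allAssignments k ] nonSharingWeight (false ∷ C) (false ∷ α) c (false ∷ r)) + totalWeight C α c
      ≡⟨ cong (_+ totalWeight C α c) (∑-ε (allAssignments k) _ (λ r → ratio-0 (suc c ℕ.+ suc (trueLits C r)))) ⟩
    0ℚ + totalWeight C α c
      ≡⟨ +-identityˡ _ ⟩
    totalWeight C α c
      ∎
    where open ≡-Reasoning

  totalWeight-litFalse : ∀ {k} c₀ (C : Clause k) x (α : Assignment k) c → eqB x c₀ ≡ false →
                         totalWeight (c₀ ∷ C) (x ∷ α) c ≡ totalWeight C α c + totalWeight C α (suc c)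
  totalWeight-litFalse {k} false C true α c _ =
    trans (∑ₐ-∷ true (nonSharingWeight (false ∷ C) (true ∷ α) c))
          (cong (totalWeight C α c +_) (∑-cong (allAssignments k) (nonSharingWeight-shift C α c)))
  totalWeight-litFalse {k} true C false α c _ =
    trans (∑ₐ-∷ false (nonSharingWeight (true ∷ C) (false ∷ α) c))
          (cong (totalWeight C α c +_) (∑-cong (allAssignments k) (nonSharingWeight-shift C α c)))

  totalWeight≤ : ∀ {k} (C : Clause k) (α : Assignment k) c → totalWeight C α c ≤ harmonicBinomial k c
  totalWeight≤ []       []      c = ≤-reflexive (totalWeight-[] c)
  totalWeight≤ {suc k} (c₀ ∷ C) (x ∷ α) c = by-literal (eqB x c₀) refl
    where
    open ≤-Reasoning
    by-literal : ∀ b → eqB x c₀ ≡ b → totalWeight (c₀ ∷ C) (x ∷ α) c ≤ harmonicBinomial (suc k) c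
    by-literal true  l = begin
      totalWeight (c₀ ∷ C) (x ∷ α) c               ≡⟨ totalWeight-litTrue c₀ C x α c l ⟩
      totalWeight C α c                            ≤⟨ totalWeight≤ C α c ⟩
      harmonicBinomial k c                         ≤⟨ harmonicBinomial≤-suc k c ⟩
      harmonicBinomial (suc k) c                   ∎
    by-literal false l = begin
      totalWeight (c₀ ∷ C) (x ∷ α) c               ≡⟨ totalWeight-litFalse c₀ C x α c l ⟩
      totalWeight C α c + totalWeight C α (suc c)  ≤⟨ +-mono-≤ (totalWeight≤ C α c) (totalWeight≤ C α (suc c)) ⟩
      harmonicBinomial (suc k) c                   ∎

  -- The coordinate of a true literal of α is fixed in every r that contributes, which saves one doubling.
  totalWeight≤-satisfied : ∀ {m} (C : Clause (suc m)) (α : Assignment (suc m)) c → trueLits C α ≢ 0 →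
                           totalWeight C α c ≤ harmonicBinomial m c
  totalWeight≤-satisfied {m} (c₀ ∷ C) (x ∷ α) c t≢0 = by-literal (eqB x c₀) refl
    where
    open ≤-Reasoning
    by-literal : ∀ b → eqB x c₀ ≡ b → totalWeight (c₀ ∷ C) (x ∷ α) c ≤ harmonicBinomial m c
    by-literal true  l = begin
      totalWeight (c₀ ∷ C) (x ∷ α) c  ≡⟨ totalWeight-litTrue c₀ C x α c l ⟩
      totalWeight C α c               ≤⟨ totalWeight≤ C α c ⟩
      harmonicBinomial m c            ∎
    by-literal false l = tail-bound m C α (λ t≡0 → t≢0 (trans (cong (λ b → 𝟙 b ℕ.+ trueLits C α) l) t≡0))
      where
      tail-bound : ∀ n (C′ : Clause n) (α′ : Assignment n) → trueLits C′ α′ ≢ 0 →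
                   totalWeight (c₀ ∷ C′) (x ∷ α′) c ≤ harmonicBinomial n c
      tail-bound zero    [] [] t′≢0 = ⊥-elim (t′≢0 refl)
      tail-bound (suc n) C′ α′ t′≢0 = begin
        totalWeight (c₀ ∷ C′) (x ∷ α′) c                ≡⟨ totalWeight-litFalse c₀ C′ x α′ c l ⟩
        totalWeight C′ α′ c + totalWeight C′ α′ (suc c)  ≤⟨ +-mono-≤ (totalWeight≤-satisfied C′ α′ c t′≢0)
                                                                     (totalWeight≤-satisfied C′ α′ (suc c) t′≢0) ⟩
        harmonicBinomial (suc n) c                      ∎

  average-totalWeight≤ : ∀ m (C : Clause (suc m)) (α : Assignment (suc m)) → trueLits C α ≢ 0 →
                         ratio 1 (2 ^ suc m) * totalWeight C α 0 ≤ ratio 1 (suc m)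
  average-totalWeight≤ m C α t≢0 = ratio1*≤ m (2 ^ suc m) (ℕ.m^n>0 2 (suc m)) (begin
    fromℕ (suc m) * totalWeight C α 0
      ≤⟨ *-monoˡ-≤-nonNeg (fromℕ (suc m)) {{pos⇒nonNeg (fromℕ (suc m)) {{fromℕ-pos m}}}}
                          (totalWeight≤-satisfied C α 0 t≢0) ⟩
    fromℕ (suc m) * harmonicBinomial m 0  ≡⟨ harmonicBinomial-0 m ⟩
    fromℕ (2 ^ suc m) - 1ℚ                ≤⟨ p-1≤p (fromℕ (2 ^ suc m)) ⟩
    fromℕ (2 ^ suc m)                     ∎)
    where
    open ≤-Reasoning
    p-1≤p : ∀ p → p - 1ℚ ≤ p
    p-1≤p p = ≤-trans (+-monoʳ-≤ p (neg-antimono-≤ (fromℕ-mono-≤ {0} {1} ℕ.z≤n))) (≤-reflexive (+-identityʳ p))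

  midpoint-bound : ∀ {k} (C : Clause k) (αs r αe : Assignment k) → trueLits C αs ≢ 0 → trueLits C αe ≢ 0 →
                   (1ℚ - nonSharingWeight C αs 0 r) - nonSharingWeight C αe 0 r
                   ≤ ratio (#satisfyingPaths C αs r αe) (#paths αs r αe)
  midpoint-bound C αs r αe t₁≢0 t₂≢0 =
    subst (λ s → (1ℚ - nonSharingWeight C αs 0 r) - ratio (𝟙 (s ≡ᵇ 0)) (suc (trueLits C r))
                 ≤ ratio (#satisfyingPaths C αs r αe) (#paths αs r αe))
          (sharedTrueLits-sym C r αe)
          (ratio-lower-bound (#paths αs r αe) (#satisfyingPaths C αs r αe) (trueLits C r)
                             (𝟙 (sharedTrueLits C αs r ≡ᵇ 0)) (𝟙 (sharedTrueLits C r αe ≡ᵇ 0))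
                             (#paths≥1 αs r αe) (#satisfyingPaths-bound C αs r αe t₁≢0 t₂≢0))

  probSat-bound : ∀ m (C : Clause (suc m)) (αs αe : Assignment (suc m)) → trueLits C αs ≢ 0 → trueLits C αe ≢ 0 →
                  (1ℚ - ratio 1 (suc m)) - ratio 1 (suc m) ≤ probSat (suc m) C αs αe
  probSat-bound m C αs αe t₁≢0 t₂≢0 = begin
    (1ℚ - ratio 1 (suc m)) - ratio 1 (suc m)
      ≤⟨ 1-a-b-antitone (average-totalWeight≤ m C αs t₁≢0) (average-totalWeight≤ m C αe t₂≢0) ⟩
    (1ℚ - R * W₁) - R * W₂
      ≡⟨ cong (λ y → (y - R * W₁) - R * W₂) (ratio1*fromℕ N (ℕ.m^n>0 2 (suc m))) ⟨
    (R * fromℕ N - R * W₁) - R * W₂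
      ≡⟨ solve 4 (λ R N W₁ W₂ → R :* ((N :- W₁) :- W₂) := (R :* N :- R :* W₁) :- R :* W₂) refl R (fromℕ N) W₁ W₂ ⟨
    R * ((fromℕ N - W₁) - W₂)
      ≡⟨ cong (λ n → R * ((fromℕ n - W₁) - W₂)) (length-allAssignments (suc m)) ⟨
    R * ((fromℕ (length rs) - W₁) - W₂)
      ≡⟨ cong (R *_) (∑-1-minus rs (nonSharingWeight C αs 0) (nonSharingWeight C αe 0)) ⟨
    R * ∑[ r ∈ rs ] ((1ℚ - nonSharingWeight C αs 0 r) - nonSharingWeight C αe 0 r)
      ≤⟨ *-monoˡ-≤-nonNeg R {{ratio-nonNeg 1 N}} (∑-mono rs (λ r → midpoint-bound C αs r αe t₁≢0 t₂≢0)) ⟩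
    R * ∑[ r ∈ rs ] ratio (#satisfyingPaths C αs r αe) (#paths αs r αe)
      ∎
    where
    open ≤-Reasoning
    open +-*-Solver
    N = 2 ^ suc m
    R = ratio 1 N
    rs = allAssignments (suc m)
    W₁ = totalWeight C αs 0
    W₂ = totalWeight C αe 0

open import Data.Bool using (T)
open import Data.Nat using (ℕ; _≤_; _∸_; z≤n; s≤s)
open import Data.Nat.Properties using (n≤1+n)
open import Data.Rational using (1ℚ; _-_; _≤_)
open import Data.Rational.Properties using (≤-trans; ≤-refl)
open Combinatorics using (trueLits; satisfies⇒trueLits≢0)
open Probability using (1-a-b-antitone; ratio1-antitone; probSat-bound)

lemma5p2 : (k : ℕ) → 3 Data.Nat.≤ k → (C : Clause k) (αstart αend : Assignment k)
    → T (satisfies C αstart) → T (satisfies C αend)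
    → (1ℚ - ratio 1 (k ∸ 1)) - ratio 1 k Data.Rational.≤ probSat k C αstart αend
lemma5p2 (suc (suc (suc n))) (s≤s (s≤s (s≤s z≤n))) C αstart αend sat₁ sat₂ =
  ≤-trans (1-a-b-antitone (ratio1-antitone (n≤1+n (suc n))) ≤-refl)
          (probSat-bound (suc (suc n)) C αstart αend (satisfied αstart sat₁) (satisfied αend sat₂))
  where
  satisfied : ∀ α → T (satisfies C α) → trueLits C α ≢ 0
  satisfied α sat = satisfies⇒trueLits≢0 C α (Equivalence.to T-≡ sat)
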